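{- Let $d\ge2$, $n\ge1$, and let $H\colon\mathbb{C}^n\to\mathbb{C}^n$ have components $H_i(X)=\sum_{|\alpha|=d}\frac{H_{i,\alpha}}{\alpha!}X^\alpha$. Suppose $(JH)^p=0$ for some integer $1\le p\le n$. Then for every $n$-type tree $\mathcal{T}=(T,\tau)$ with $T\in\mathcal{C}_k^{(d)}$ and every ancestral path $(v_0,\dots,v_p)$ in $\mathcal{T}$, $$\sum_{\mathcal{T}'\in\mathrm{Sh}(\mathcal{T};v_0,\dots,v_p)}\mathcal{E}_H(\mathcal{T}')=0.$$
   Context: $[n]=\{1,\dots,n\}$; $\alpha!=\prod\alpha_j!$, $|\alpha|=\sum\alpha_j$. A $d$-Catalan tree is a rooted planar tree in which every vertex has $0$ or $d$ children; $\mathcal{C}_k^{(d)}$ is the set of such trees with $k$ internal vertices. An $n$-type tree $\mathcal{T}=(T,\tau)$ is a tree with a type map $\tau$ from vertices to $[n]$. An ancestral path $(v_0,\dots,v_p)$ has each $v_i$ a child of $v_{i-1}$. The labelled shuffle class $\mathrm{Sh}(\mathcal{T};v_0,\dots,v_p)$ is the set of (distinct) $n$-type trees obtainable from $\mathcal{T}$ by rearranging the labelled subtrees subtended by the $(d-1)p$ siblings of $v_1,\dots,v_p$ among these sibling positions, and giving arbitrary new types in $[n]$ to $v_1,\dots,v_{p-1}$. For an internal vertex $v$, $\mu(v)\in\mathbb{Z}_{\ge0}^n$ counts its children of each type; the $H$-weight is $\mathcal{E}_H(\mathcal{T})=\prod_{v\text{ internal}}H_{\tau(v),\mu(v)}$.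 -}

module Defs where

open import Level using (Level; _⊔_)
open import Algebra.Bundles using (CommutativeRing)
open import Data.Bool using (Bool; true; false; if_then_else_; _∧_)
open import Data.Nat as ℕ using (ℕ; zero; suc; _∸_)
open import Data.Nat using (_!)
import Data.Nat.ListAction as ℕL
open import Data.Fin as Fin using (Fin)
open import Data.Fin.Properties as FinP using ()
open import Data.Vec as Vec using (Vec; []; _∷_; lookup; updateAt; toList; fromList)
open import Data.List as List using (List; []; _∷_; _++_; map; concatMap; foldr; allFin; filter; length; upTo; zip)
open import Data.Maybe using (Maybe; just; nothing)
open import Data.Product using (_×_; _,_)
open import Relation.Nullary using (¬_; does; ¬?)
open import Relation.Nullary.Decidable using (⌊_⌋)
import Data.List.Relation.Unary.Unique.DecPropositional as UniqueDec

allVecs : (k m : ℕ) → List (Vec (Fin k) m)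
allVecs k zero    = [] ∷ []
allVecs k (suc m) = concatMap (λ i → map (i ∷_) (allVecs k m)) (allFin k)

perms : (m : ℕ) → List (Vec (Fin m) m)
perms m = filter (λ v → UniqueDec.unique? Fin._≟_ (toList v)) (allVecs m m)

below : ∀ {n} → Vec ℕ n → List (Vec ℕ n)
below []      = [] ∷ []
below (g ∷ γ) = concatMap (λ b → map (b ∷_) (below γ)) (upTo (suc g))

∣_∣ₘ : ∀ {n} → Vec ℕ n → ℕ
∣ α ∣ₘ = Vec.sum α

_!ₘ : ∀ {n} → Vec ℕ n → ℕ
α !ₘ = ℕL.product (List.map _! (toList α))

isZeroᵥ : ∀ {n} → Vec ℕ n → Bool
isZeroᵥ []      = true
isZeroᵥ (g ∷ γ) = ⌊ g ℕ.≟ 0 ⌋ ∧ isZeroᵥ γ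

-- n-type d-Catalan trees (rooted planar; each vertex has 0 or d children,
-- children ordered by Fin d; every vertex carries a type in Fin n).

data Tree (d n : ℕ) : Set where
  leaf : Fin n → Tree d n
  node : Fin n → (Fin d → Tree d n) → Tree d n

-- A vertex is addressed by the sequence of child indices from the root.
Address : ℕ → Set
Address d = List (Fin d)

module _ {d n : ℕ} where

  rootType : Tree d n → Fin n
  rootType (leaf a)   = a
  rootType (node a _) = a

  subtreeAt : Tree d n → Address d → Maybe (Tree d n)
  subtreeAt t          []       = just t
  subtreeAt (leaf _)   (_ ∷ _)  = nothing
  subtreeAt (node a f) (c ∷ cs) = subtreeAt (f c) cs

  -- replace the subtree at an address (no-op if the address does not exist
  -- or the replacement is `nothing`)
  graft : Tree d n → Address d → Maybe (Tree d n) → Tree d n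
  graft t          []       (just s) = s
  graft t          []       nothing  = t
  graft (leaf a)   (_ ∷ _)  _        = leaf a
  graft (node a f) (c ∷ cs) ms       =
    node a (λ j → if does (j Fin.≟ c) then graft (f j) cs ms else f j)

  retype : Tree d n → Address d → Fin n → Tree d n
  retype (leaf _)   []       b = leaf b
  retype (node _ f) []       b = node b f
  retype (leaf a)   (_ ∷ _)  b = leaf a
  retype (node a f) (c ∷ cs) b =
    node a (λ j → if does (j Fin.≟ c) then retype (f j) cs b else f j)

  -- Ancestral path (v₀,…,v_p): v₀ at address a, vᵢ = child cᵢ of vᵢ₋₁.

  -- addresses of the siblings of v₁,…,v_p, in order (length (d-1)p)
  siblingAddrs : Address d → List (Fin d) → List (Address d)
  siblingAddrs a []       = []
  siblingAddrs a (c ∷ cs) =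
    map (λ j → a ++ (j ∷ [])) (filter (λ j → ¬? (j Fin.≟ c)) (allFin d))
    ++ siblingAddrs (a ++ (c ∷ [])) cs

  innerAddrs : Address d → List (Fin d) → List (Address d)
  innerAddrs a []            = []
  innerAddrs a (c ∷ [])      = []
  innerAddrs a (c ∷ c' ∷ cs) = (a ++ (c ∷ [])) ∷ innerAddrs (a ++ (c ∷ [])) (c' ∷ cs)

  -- rearrange the subtrees at the given positions: slot s receives the
  -- (original) subtree that sat at slot σ(s)
  permuteSubtrees : ∀ {m} → Tree d n → Vec (Address d) m → Vec (Fin m) m → Tree d n
  permuteSubtrees {m} t ps σ =
    foldr (λ s acc → graft acc (lookup ps s) (subtreeAt t (lookup ps (lookup σ s))))
          t (allFin m)

  retypeAll : Tree d n → List (Address d × Fin n) → Tree d n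
  retypeAll t []              = t
  retypeAll t ((a , b) ∷ abs) = retypeAll (retype t a b) abs

  -- labelled shuffle class Sh(𝒯; v₀,…,v_p), listed without repetition
  -- (one entry per rearrangement of the labelled sibling subtrees and per
  -- choice of new types of v₁,…,v_{p-1})
  shuffleClass : ∀ {p} → Tree d n → Address d → Vec (Fin d) p → List (Tree d n)
  shuffleClass {p} t a cs =
    concatMap
      (λ σ → map (λ ρ → retypeAll (permuteSubtrees t ps σ)
                                  (zip (innerAddrs a (toList cs)) (toList ρ)))
                 (allVecs n (p ∸ 1)))
      (perms (length sibs))
    where
      sibs = siblingAddrs a (toList cs)
      ps   = fromList sibs

  childTypeCount : (Fin d → Tree d n) → Vec ℕ n
  childTypeCount f =
    Vec.tabulate (λ i → ℕL.sum (map (λ j → if does (rootType (f j) Fin.≟ i) then 1 else 0)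
                                      (allFin d)))

  -- an ancestral path exists: v₀,…,v_p all exist (hence v₀,…,v_{p-1} internal)
  ValidPath : ∀ {p} → Tree d n → Address d → Vec (Fin d) p → Set
  ValidPath t a cs = Data.Maybe.Is-just (subtreeAt t (a ++ toList cs))
    where import Data.Maybe

module _ {c ℓ : Level} (R : CommutativeRing c ℓ) where
  open CommutativeRing R

  ℕ→R : ℕ → Carrier
  ℕ→R zero    = 0#
  ℕ→R (suc m) = 1# + ℕ→R m

  record IsCharZeroField : Set (c ⊔ ℓ) where
    field
      inv    : (x : Carrier) → ¬ (x ≈ 0#) → Carrier
      inverse : ∀ x (nz : ¬ (x ≈ 0#)) → inv x nz * x ≈ 1#
      char0  : ∀ m → ¬ (ℕ→R (suc m) ≈ 0#)

  sumR : List Carrier → Carrier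
  sumR = foldr _+_ 0#

  prodR : List Carrier → Carrier
  prodR = foldr _*_ 1#

  -- polynomials in X₁,…,Xₙ as coefficient functions on exponent vectors
  Poly : ℕ → Set c
  Poly n = Vec ℕ n → Carrier

  _⊛_ : ∀ {n} → Poly n → Poly n → Poly n
  (f ⊛ g) γ = sumR (map (λ β → f β * g (Vec.zipWith _∸_ γ β)) (below γ))

  _⊕_ : ∀ {n} → Poly n → Poly n → Poly n
  (f ⊕ g) γ = f γ + g γ

  0ₚ : ∀ {n} → Poly n
  0ₚ _ = 0#

  1ₚ : ∀ {n} → Poly n
  1ₚ γ = if isZeroᵥ γ then 1# else 0#

  PolyMat : ℕ → Set c
  PolyMat n = Fin n → Fin n → Poly n

  matMul : ∀ {n} → PolyMat n → PolyMat n → PolyMat n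
  matMul {n} A B i j = foldr (λ k acc → (A i k ⊛ B k j) ⊕ acc) 0ₚ (allFin n)

  idMat : ∀ {n} → PolyMat n
  idMat i j = if does (i Fin.≟ j) then 1ₚ else 0ₚ

  matPow : ∀ {n} → PolyMat n → ℕ → PolyMat n
  matPow M zero    = idMat
  matPow M (suc p) = matMul (matPow M p) M

  module _ (F : IsCharZeroField) where
    open IsCharZeroField F

    -- 1/m (junk value 0 at m = 0, never used below since α! ≥ 1)
    invℕ : ℕ → Carrier
    invℕ zero    = 0#
    invℕ (suc m) = inv (ℕ→R (suc m)) (char0 m)

    homogMap : (d n : ℕ) → (Fin n → Vec ℕ n → Carrier) → Fin n → Poly n
    homogMap d n H i α =
      if does (∣ α ∣ₘ ℕ.≟ d) then H i α * invℕ (α !ₘ) else 0#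

    ∂ : ∀ {n} → Fin n → Poly n → Poly n
    ∂ j f β = ℕ→R (suc (lookup β j)) * f (updateAt β j suc)

    jacobian : (d n : ℕ) → (Fin n → Vec ℕ n → Carrier) → PolyMat n
    jacobian d n H i j = ∂ j (homogMap d n H i)

    JacNilp : (d n : ℕ) → (Fin n → Vec ℕ n → Carrier) → ℕ → Set ℓ
    JacNilp d n H p = ∀ i j γ → matPow (jacobian d n H) p i j γ ≈ 0#

  weightH : ∀ {d n} → (Fin n → Vec ℕ n → Carrier) → Tree d n → Carrier
  weightH H (leaf _)   = 1#
  weightH {d} H (node a f) =
    H a (childTypeCount f) * prodR (map (λ j → weightH H (f j)) (allFin d))

-- Write e = d - 1 and follow the path v₀, …, v_p. Moving the labelled sibling subtrees around
-- and retyping v₁, …, v_{p-1} changes only the weights of v₀, …, v_{p-1}, so the weight of a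
-- member of the shuffle class is K · ℰ(v_p) · ∏ ℰ(siblings) · ∏_{i<p} H_{τ(vᵢ), μ(vᵢ)} with K and the
-- first two products fixed. The last product only sees the word of sibling types read along the
-- path in blocks of e letters. Summing over the new inner types turns it into a sum over type
-- paths, and summing over the arrangements of the siblings sees each word of content γ exactly
-- γ! times. Since e! ∂ⱼHₖ = Σ_{s ∈ [n]^e} H_{k, μ(j s)} X^{μ(s)}, the resulting sum over words is
-- (e!)^p times the coefficient of X^γ in ((JH)^p)_{τ(v₀) τ(v_p)}, which vanishes.

module Submission where

open import Defs
open import Level using (Level)
open import Algebra.Bundles using (CommutativeRing; Semiring)
open import Data.Bool using (Bool; true; false; if_then_else_; _∧_)
open import Data.Empty using (⊥)
open import Data.Fin as Fin using (Fin; punchIn)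
open import Data.Fin.Properties using (punchInᵢ≢i; punchIn-injective; suc-injective)
open import Data.List as List
  using (List; []; _∷_; _++_; allFin; concatMap; tabulate; take; drop; length; zip; map)
import Data.List.Properties as Listₚ
open import Data.List.Membership.Propositional using (_∈_)
open import Data.List.Relation.Unary.All as All using (All; []; _∷_)
import Data.List.Relation.Unary.All.Properties as Allₚ
open import Data.List.Relation.Unary.AllPairs using (_∷_)
open import Data.List.Relation.Unary.Any using (here; there)
open import Data.List.Relation.Unary.Unique.Propositional using (Unique)
import Data.List.Relation.Unary.Unique.Propositional.Properties as Uniqueₚ
import Data.List.Relation.Unary.Unique.DecPropositional as UniqueDec
open import Data.Maybe using (Maybe; just; nothing; Is-just)
import Data.Maybe.Relation.Unary.Any as MaybeAny
open import Data.Nat as ℕ using (ℕ; zero; suc; _!; _∸_; _≤_; z≤n; s≤s)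
import Data.Nat.ListAction as ℕL
import Data.Nat.Properties as ℕₚ
open import Data.Product using (_×_; _,_; proj₁; proj₂; Σ)
open import Data.Unit using (⊤; tt)
open import Data.Vec as Vec using (Vec; []; _∷_; lookup; updateAt; toList)
import Data.Vec.Properties as Vecₚ
open import Function using (_∘_; mk⇔)
open import Relation.Binary.PropositionalEquality as ≡ using (_≡_; _≢_)
open import Relation.Nullary using (Dec; yes; no; does; ¬?)
open import Relation.Nullary.Decidable using (dec-true; dec-false; does-⇔)

-- Multi-indices

_≟ᵥ_ : ∀ {n} (u v : Vec ℕ n) → Dec (u ≡ v)
_≟ᵥ_ = Vecₚ.≡-dec ℕ._≟_

count : ∀ {n} → List (Fin n) → Vec ℕ n
count {n} []       = Vec.replicate n 0
count     (x ∷ xs) = updateAt (count xs) x suc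

private
  variable
    k : ℕ

updateAt-suc-comm : ∀ (v : Vec ℕ k) a b →
                    updateAt (updateAt v a suc) b suc ≡ updateAt (updateAt v b suc) a suc
updateAt-suc-comm v a b with a Fin.≟ b
... | yes ≡.refl = ≡.refl
... | no a≢b     = ≡.sym (Vecₚ.updateAt-commutes a b a≢b v)

updateAt-pred-suc : ∀ (v : Vec ℕ k) c → updateAt (updateAt v c suc) c ℕ.pred ≡ v
updateAt-pred-suc v c = ≡.trans (Vecₚ.updateAt-updateAt c v) (Vecₚ.updateAt-id c v)

updateAt-suc-pred : ∀ (v : Vec ℕ k) c {m} → lookup v c ≡ suc m →
                    updateAt (updateAt v c ℕ.pred) c suc ≡ v
updateAt-suc-pred v c eq = ≡.trans (Vecₚ.updateAt-updateAt c v)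
  (Vecₚ.updateAt-id-local c v (≡.trans (≡.cong (suc ∘ ℕ.pred) eq) (≡.sym eq)))

∣∣ₘ-updateAt-suc : ∀ (β : Vec ℕ k) c → ∣ updateAt β c suc ∣ₘ ≡ suc ∣ β ∣ₘ
∣∣ₘ-updateAt-suc (b ∷ β) Fin.zero    = ≡.refl
∣∣ₘ-updateAt-suc (b ∷ β) (Fin.suc c) =
  ≡.trans (≡.cong (b ℕ.+_) (∣∣ₘ-updateAt-suc β c)) (ℕₚ.+-suc b _)

∣∣ₘ-updateAt-pred : ∀ (β : Vec ℕ k) c {m} → lookup β c ≡ suc m →
                    ∣ β ∣ₘ ≡ suc ∣ updateAt β c ℕ.pred ∣ₘ
∣∣ₘ-updateAt-pred β c eq = ≡.trans (≡.cong ∣_∣ₘ (≡.sym (updateAt-suc-pred β c eq)))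
                                   (∣∣ₘ-updateAt-suc (updateAt β c ℕ.pred) c)

!ₘ-updateAt-pred : ∀ (γ : Vec ℕ k) c {m} → lookup γ c ≡ suc m →
                   γ !ₘ ≡ suc m ℕ.* (updateAt γ c ℕ.pred) !ₘ
!ₘ-updateAt-pred (a ∷ γ) Fin.zero {m} ≡.refl = ℕₚ.*-assoc (suc m) (m !) _
!ₘ-updateAt-pred (a ∷ γ) (Fin.suc c) {m} eq = begin
  a ! ℕ.* γ !ₘ                                  ≡⟨ ≡.cong (a ! ℕ.*_) (!ₘ-updateAt-pred γ c eq) ⟩
  a ! ℕ.* (suc m ℕ.* (updateAt γ c ℕ.pred) !ₘ)  ≡⟨ ℕₚ.*-assoc (a !) (suc m) _ ⟨
  a ! ℕ.* suc m ℕ.* (updateAt γ c ℕ.pred) !ₘ    ≡⟨ ≡.cong (ℕ._* (updateAt γ c ℕ.pred) !ₘ) (ℕₚ.*-comm (a !) (suc m)) ⟩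
  suc m ℕ.* a ! ℕ.* (updateAt γ c ℕ.pred) !ₘ    ≡⟨ ℕₚ.*-assoc (suc m) (a !) _ ⟩
  suc m ℕ.* (a ! ℕ.* (updateAt γ c ℕ.pred) !ₘ)  ∎
  where open ≡.≡-Reasoning

!ₘ-updateAt-suc : ∀ (β : Vec ℕ k) c → (updateAt β c suc) !ₘ ≡ suc (lookup β c) ℕ.* β !ₘ
!ₘ-updateAt-suc β c =
  ≡.trans (!ₘ-updateAt-pred (updateAt β c suc) c (Vecₚ.lookup∘updateAt c β))
          (≡.cong (λ z → suc (lookup β c) ℕ.* z !ₘ) (updateAt-pred-suc β c))

1≤!ₘ : ∀ (γ : Vec ℕ k) → 1 ≤ γ !ₘ
1≤!ₘ []      = s≤s z≤n
1≤!ₘ (g ∷ γ) = ℕₚ.*-mono-≤ (ℕₚ.1≤n! g) (1≤!ₘ γ)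

!ₘ-replicate-0 : ∀ k → Vec.replicate k 0 !ₘ ≡ 1
!ₘ-replicate-0 zero    = ≡.refl
!ₘ-replicate-0 (suc k) = ≡.trans (ℕₚ.+-identityʳ _) (!ₘ-replicate-0 k)

∣∣ₘ-replicate-0 : ∀ k → ∣ Vec.replicate k 0 ∣ₘ ≡ 0
∣∣ₘ-replicate-0 zero    = ≡.refl
∣∣ₘ-replicate-0 (suc k) = ∣∣ₘ-replicate-0 k

∣∣ₘ≡0⇒replicate-0 : ∀ (β : Vec ℕ k) → ∣ β ∣ₘ ≡ 0 → β ≡ Vec.replicate k 0
∣∣ₘ≡0⇒replicate-0 []       eq = ≡.refl
∣∣ₘ≡0⇒replicate-0 (0 ∷ β) eq = ≡.cong (0 ∷_) (∣∣ₘ≡0⇒replicate-0 β eq)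

isZeroᵥ≡does-replicate-0 : ∀ (γ : Vec ℕ k) → isZeroᵥ γ ≡ does (Vec.replicate k 0 ≟ᵥ γ)
isZeroᵥ≡does-replicate-0 []          = ≡.refl
isZeroᵥ≡does-replicate-0 (zero ∷ γ)  = isZeroᵥ≡does-replicate-0 γ
isZeroᵥ≡does-replicate-0 (suc g ∷ γ) = ≡.refl

module _ {n : ℕ} where

  count-++ : ∀ (xs ys : List (Fin n)) → count (xs ++ ys) ≡ Vec.zipWith ℕ._+_ (count xs) (count ys)
  count-++ []       ys = ≡.sym (Vecₚ.zipWith-identityˡ ℕₚ.+-identityˡ (count ys))
  count-++ (x ∷ xs) ys = ≡.trans (≡.cong (λ z → updateAt z x suc) (count-++ xs ys))
                                 (updateAt-zipWith (count xs) (count ys) x)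
    where
    updateAt-zipWith : ∀ (u v : Vec ℕ k) i →
      updateAt (Vec.zipWith ℕ._+_ u v) i suc ≡ Vec.zipWith ℕ._+_ (updateAt u i suc) v
    updateAt-zipWith (a ∷ u) (b ∷ v) Fin.zero    = ≡.refl
    updateAt-zipWith (a ∷ u) (b ∷ v) (Fin.suc i) = ≡.cong (a ℕ.+ b ∷_) (updateAt-zipWith u v i)

  count-tabulate-punchIn : ∀ m (t : Fin (suc m) → Fin n) i →
    count (tabulate t) ≡ updateAt (count (tabulate (t ∘ punchIn i))) (t i) suc
  count-tabulate-punchIn m       t Fin.zero    = ≡.refl
  count-tabulate-punchIn (suc m) t (Fin.suc i) =
    ≡.trans (≡.cong (λ z → updateAt z (t Fin.zero) suc) (count-tabulate-punchIn m (t ∘ Fin.suc) i))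
            (updateAt-suc-comm _ (t (Fin.suc i)) (t Fin.zero))

  count-tabulate-punchIn-pred : ∀ m (t : Fin (suc m) → Fin n) i →
    count (tabulate (t ∘ punchIn i)) ≡ updateAt (count (tabulate t)) (t i) ℕ.pred
  count-tabulate-punchIn-pred m t i = ≡.sym (≡.trans
    (≡.cong (λ z → updateAt z (t i) ℕ.pred) (count-tabulate-punchIn m t i)) (updateAt-pred-suc _ (t i)))

  lookup-count-tabulate : ∀ m (t : Fin (suc m) → Fin n) i →
    lookup (count (tabulate t)) (t i) ≡ suc (lookup (count (tabulate (t ∘ punchIn i))) (t i))
  lookup-count-tabulate m t i =
    ≡.trans (≡.cong (λ z → lookup z (t i)) (count-tabulate-punchIn m t i)) (Vecₚ.lookup∘updateAt (t i) (count (tabulate (t ∘ punchIn i))))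

  lookup-count : ∀ (ts : List (Fin n)) i →
                 lookup (count ts) i ≡ ℕL.sum (List.map (λ t → if does (t Fin.≟ i) then 1 else 0) ts)
  lookup-count []       i = Vecₚ.lookup-replicate i 0
  lookup-count (t ∷ ts) i with t Fin.≟ i
  ... | yes ≡.refl = ≡.trans (Vecₚ.lookup∘updateAt t (count ts)) (≡.cong suc (lookup-count ts i))
  ... | no t≢i     = ≡.trans (Vecₚ.lookup∘updateAt′ i t (t≢i ∘ ≡.sym) (count ts)) (lookup-count ts i)

length-take-+ : ∀ {A : Set} k (xs : List A) {m} → length xs ≡ k ℕ.+ m → length (take k xs) ≡ k
length-take-+ zero    xs       eq = ≡.refl
length-take-+ (suc k) (x ∷ xs) eq = ≡.cong suc (length-take-+ k xs (ℕₚ.suc-injective eq))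

length-drop-+ : ∀ {A : Set} k (xs : List A) {m} → length xs ≡ k ℕ.+ m → length (drop k xs) ≡ m
length-drop-+ zero    xs       eq = eq
length-drop-+ (suc k) (x ∷ xs) eq = length-drop-+ k xs (ℕₚ.suc-injective eq)

zip-++ : ∀ {A B : Set} (xs xs′ : List A) (ys ys′ : List B) → length xs ≡ length ys →
         zip (xs ++ xs′) (ys ++ ys′) ≡ zip xs ys ++ zip xs′ ys′
zip-++ []       xs′ []       ys′ _  = ≡.refl
zip-++ (x ∷ xs) xs′ (y ∷ ys) ys′ eq = ≡.cong ((x , y) ∷_) (zip-++ xs xs′ ys ys′ (ℕₚ.suc-injective eq))

-- Tree surgery along an ancestral path

module Trees (e n : ℕ) where

  d : ℕ
  d = suc e

  T : Set
  T = Tree d n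

  -- trees are compared extensionally, since grafting rebuilds the child functions
  infix 4 _≋_
  data _≋_ : T → T → Set where
    leaf≋ : ∀ {a} → leaf a ≋ leaf a
    node≋ : ∀ {a f g} → (∀ j → f j ≋ g j) → node a f ≋ node a g

  ≋-refl : ∀ {t} → t ≋ t
  ≋-refl {leaf a}   = leaf≋
  ≋-refl {node a f} = node≋ (λ j → ≋-refl)

  ≋-reflexive : ∀ {t u} → t ≡ u → t ≋ u
  ≋-reflexive ≡.refl = ≋-refl

  ≋-sym : ∀ {t u} → t ≋ u → u ≋ t
  ≋-sym leaf≋     = leaf≋
  ≋-sym (node≋ p) = node≋ (λ j → ≋-sym (p j))

  ≋-trans : ∀ {t u v} → t ≋ u → u ≋ v → t ≋ v
  ≋-trans leaf≋     leaf≋     = leaf≋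
  ≋-trans (node≋ p) (node≋ q) = node≋ (λ j → ≋-trans (p j) (q j))

  rootType-≋ : ∀ {t u} → t ≋ u → rootType t ≡ rootType u
  rootType-≋ leaf≋     = ≡.refl
  rootType-≋ (node≋ _) = ≡.refl

  modifyChild : Fin d → (T → T) → (Fin d → T) → Fin d → T
  modifyChild c φ f j = if does (j Fin.≟ c) then φ (f j) else f j

  modifyChild-cong : ∀ c {φ ψ : T → T} {f g : Fin d → T} → (∀ j → f j ≋ g j) →
                     (∀ {t u} → t ≋ u → φ t ≋ ψ u) → ∀ j → modifyChild c φ f j ≋ modifyChild c ψ g j
  modifyChild-cong c f≋g φ≋ψ j with does (j Fin.≟ c)
  ... | true  = φ≋ψ (f≋g j)
  ... | false = f≋g j

  graft-≋ : ∀ {t u} b ms → t ≋ u → graft t b ms ≋ graft u b ms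
  graft-≋ []      (just s) p         = ≋-refl
  graft-≋ []      nothing  p         = p
  graft-≋ (c ∷ b) ms       leaf≋     = leaf≋
  graft-≋ (c ∷ b) ms       (node≋ p) = node≋ (modifyChild-cong c p (graft-≋ b ms))

  retype-≋ : ∀ {t u} b r → t ≋ u → retype t b r ≋ retype u b r
  retype-≋ []      r leaf≋     = leaf≋
  retype-≋ []      r (node≋ p) = node≋ p
  retype-≋ (c ∷ b) r leaf≋     = leaf≋
  retype-≋ (c ∷ b) r (node≋ p) = node≋ (modifyChild-cong c p (retype-≋ b r))

  retypeAll-≋ : ∀ {t u} L → t ≋ u → retypeAll t L ≋ retypeAll u L
  retypeAll-≋ []            p = p
  retypeAll-≋ ((b , r) ∷ L) p = retypeAll-≋ L (retype-≋ b r p)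

  graftAll : T → List (Address d × Maybe T) → T
  graftAll = List.foldr (λ (b , ms) t → graft t b ms)

  modifyAt : T → Address d → (T → T) → T
  modifyAt t          []      φ = φ t
  modifyAt (leaf x)   (c ∷ a) φ = leaf x
  modifyAt (node x f) (c ∷ a) φ = node x (modifyChild c (λ u → modifyAt u a φ) f)

  modifyChild-≗ : ∀ c {φ ψ : T → T} f → (∀ t → φ t ≋ ψ t) → ∀ j → modifyChild c φ f j ≋ modifyChild c ψ f j
  modifyChild-≗ c f φ≋ψ j with does (j Fin.≟ c)
  ... | true  = φ≋ψ (f j)
  ... | false = ≋-refl

  modifyAt-id : ∀ t a → modifyAt t a (λ u → u) ≋ t
  modifyAt-id t          []      = ≋-refl
  modifyAt-id (leaf x)   (c ∷ a) = leaf≋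
  modifyAt-id (node x f) (c ∷ a) = node≋ (λ j → ≋-trans (modifyChild-≗ c f (λ u → modifyAt-id u a) j) (modifyChild-id j))
    where
    modifyChild-id : ∀ j → modifyChild c (λ u → u) f j ≋ f j
    modifyChild-id j with does (j Fin.≟ c)
    ... | true  = ≋-refl
    ... | false = ≋-refl

  modifyAt-∘ : ∀ t a φ ψ → modifyAt (modifyAt t a φ) a ψ ≋ modifyAt t a (ψ ∘ φ)
  modifyAt-∘ t          []      φ ψ = ≋-refl
  modifyAt-∘ (leaf x)   (c ∷ a) φ ψ = leaf≋
  modifyAt-∘ (node x f) (c ∷ a) φ ψ = node≋ childwise
    where
    childwise : ∀ j → modifyChild c (λ u → modifyAt u a ψ) (modifyChild c (λ u → modifyAt u a φ) f) j
             ≋ modifyChild c (λ u → modifyAt u a (ψ ∘ φ)) f j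
    childwise j with does (j Fin.≟ c)
    ... | true  = modifyAt-∘ (f j) a φ ψ
    ... | false = ≋-refl

  graft-++ : ∀ t a b ms → graft t (a ++ b) ms ≋ modifyAt t a (λ u → graft u b ms)
  graft-++ t          []      b ms = ≋-refl
  graft-++ (leaf x)   (c ∷ a) b ms = leaf≋
  graft-++ (node x f) (c ∷ a) b ms = node≋ (modifyChild-≗ c f (λ u → graft-++ u a b ms))

  retype-++ : ∀ t a b r → retype t (a ++ b) r ≋ modifyAt t a (λ u → retype u b r)
  retype-++ t          []      b r = ≋-refl
  retype-++ (leaf x)   (c ∷ a) b r = leaf≋
  retype-++ (node x f) (c ∷ a) b r = node≋ (modifyChild-≗ c f (λ u → retype-++ u a b r))

  rootType-modifyAt : ∀ t a {u} φ → subtreeAt t a ≡ just u → rootType (φ u) ≡ rootType u →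
                      rootType (modifyAt t a φ) ≡ rootType t
  rootType-modifyAt t          []      φ ≡.refl r = r
  rootType-modifyAt (node x f) (c ∷ a) φ _      r = ≡.refl

  prefixAll : ∀ {A : Set} → Address d → List (Address d × A) → List (Address d × A)
  prefixAll a = List.map (λ (b , v) → (a ++ b , v))

  graftAll-prefixAll : ∀ t a L → graftAll t (prefixAll a L) ≋ modifyAt t a (λ u → graftAll u L)
  graftAll-prefixAll t a []              = ≋-sym (modifyAt-id t a)
  graftAll-prefixAll t a ((b , ms) ∷ L) =
    ≋-trans (graft-≋ (a ++ b) ms (graftAll-prefixAll t a L))
      (≋-trans (graft-++ (modifyAt t a (λ u → graftAll u L)) a b ms)
               (modifyAt-∘ t a (λ u → graftAll u L) (λ u → graft u b ms)))

  retypeAll-prefixAll : ∀ t a φ L →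
    retypeAll (modifyAt t a φ) (prefixAll a L) ≋ modifyAt t a (λ u → retypeAll (φ u) L)
  retypeAll-prefixAll t a φ []             = ≋-refl
  retypeAll-prefixAll t a φ ((b , r) ∷ L) =
    ≋-trans (retypeAll-≋ (prefixAll a L) (≋-trans (retype-++ (modifyAt t a φ) a b r)
                                                  (modifyAt-∘ t a φ (λ u → retype u b r))))
            (retypeAll-prefixAll t a (λ u → retype (φ u) b r) L)

  inChild : ∀ {A : Set} → Fin d → List (Address d × A) → List (Address d × A)
  inChild j []                = []
  inChild j (([] , v) ∷ L)    = inChild j L
  inChild j ((c ∷ b , v) ∷ L) = if does (j Fin.≟ c) then (b , v) ∷ inChild j L else inChild j L

  NonRoot : Address d → Set
  NonRoot []      = ⊥
  NonRoot (_ ∷ _) = ⊤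

  graftAll-node : ∀ x f L → All (NonRoot ∘ proj₁) L → graftAll (node x f) L ≋ node x (λ j → graftAll (f j) (inChild j L))
  graftAll-node x f []                  _        = ≋-refl
  graftAll-node x f ((c ∷ b , ms) ∷ L) (_ ∷ nr) = ≋-trans (graft-≋ (c ∷ b) ms (graftAll-node x f L nr)) (node≋ childwise)
    where
    childwise : ∀ j → modifyChild c (λ u → graft u b ms) (λ j → graftAll (f j) (inChild j L)) j
             ≋ graftAll (f j) (inChild j ((c ∷ b , ms) ∷ L))
    childwise j with does (j Fin.≟ c)
    ... | true  = ≋-refl
    ... | false = ≋-refl

  retypeAll-node : ∀ x f L → All (NonRoot ∘ proj₁) L → retypeAll (node x f) L ≋ node x (λ j → retypeAll (f j) (inChild j L))
  retypeAll-node x f []                 _        = ≋-refl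
  retypeAll-node x f ((c ∷ b , r) ∷ L) (_ ∷ nr) = ≋-trans (retypeAll-node x _ L nr) (node≋ childwise)
    where
    childwise : ∀ j → retypeAll (modifyChild c (λ u → retype u b r) f j) (inChild j L)
             ≋ retypeAll (f j) (inChild j ((c ∷ b , r) ∷ L))
    childwise j with does (j Fin.≟ c)
    ... | true  = ≋-refl
    ... | false = ≋-refl

  inChild-++ : ∀ {A : Set} j (L L′ : List (Address d × A)) → inChild j (L ++ L′) ≡ inChild j L ++ inChild j L′
  inChild-++ j []                 L′ = ≡.refl
  inChild-++ j (([] , v) ∷ L)     L′ = inChild-++ j L L′
  inChild-++ j ((c ∷ b , v) ∷ L) L′ with does (j Fin.≟ c)
  ... | true  = ≡.cong ((b , v) ∷_) (inChild-++ j L L′)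
  ... | false = inChild-++ j L L′

  inChild-prefixAll-self : ∀ {A : Set} c (L : List (Address d × A)) → inChild c (prefixAll (c ∷ []) L) ≡ L
  inChild-prefixAll-self c []            = ≡.refl
  inChild-prefixAll-self c ((b , v) ∷ L) rewrite dec-true (c Fin.≟ c) ≡.refl =
    ≡.cong ((b , v) ∷_) (inChild-prefixAll-self c L)

  inChild-prefixAll-other : ∀ {A : Set} j c (L : List (Address d × A)) → j ≢ c → inChild j (prefixAll (c ∷ []) L) ≡ []
  inChild-prefixAll-other j c []            j≢c = ≡.refl
  inChild-prefixAll-other j c ((b , v) ∷ L) j≢c rewrite dec-false (j Fin.≟ c) j≢c =
    inChild-prefixAll-other j c L j≢c

  inChild-children-∌ : ∀ {A : Set} k ks (vs : List A) → All (k ≢_) ks →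
                       inChild k (zip (List.map (_∷ []) ks) vs) ≡ []
  inChild-children-∌ k []       vs       _          = ≡.refl
  inChild-children-∌ k (x ∷ ks) []       _          = ≡.refl
  inChild-children-∌ k (x ∷ ks) (v ∷ vs) (k≢x ∷ ps) rewrite dec-false (k Fin.≟ x) k≢x =
    inChild-children-∌ k ks vs ps

  graftAll-children : ∀ {b} {B : Set b} (f : Fin d → T) (φ : T → B) (ψ : Maybe T → B) →
    (∀ s → ψ (just s) ≡ φ s) → ∀ ks vs → Unique ks → length ks ≡ length vs → All Is-just vs →
    List.map (λ j → φ (graftAll (f j) (inChild j (zip (List.map (_∷ []) ks) vs)))) ks ≡ List.map ψ vs
  graftAll-children f φ ψ ψ≗φ []       []           _          _  _ = ≡.refl
  graftAll-children f φ ψ ψ≗φ (k ∷ ks) (just s ∷ vs) (k∉ ∷ uq) eq (_ ∷ js) = ≡.cong₂ _∷_ head tail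
    where
    L = zip (List.map (_∷ []) ks) vs
    head : φ (graftAll (f k) (inChild k ((k ∷ [] , just s) ∷ L))) ≡ ψ (just s)
    head rewrite dec-true (k Fin.≟ k) ≡.refl = ≡.sym (ψ≗φ s)
    tail : List.map (λ j → φ (graftAll (f j) (inChild j ((k ∷ [] , just s) ∷ L)))) ks ≡ List.map ψ vs
    tail = ≡.trans (Listₚ.map-cong-local (All.map (λ {j} k≢j →
                      ≡.cong (λ b → φ (graftAll (f j) (if b then ([] , just s) ∷ inChild j L else inChild j L)))
                             (dec-false (j Fin.≟ k) (k≢j ∘ ≡.sym))) k∉))
                   (graftAll-children f φ ψ ψ≗φ ks vs uq (ℕₚ.suc-injective eq) js)

  others : Fin d → List (Fin d)
  others c = List.filter (λ j → ¬? (j Fin.≟ c)) (allFin d)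

  others≡tabulate-punchIn : ∀ c → others c ≡ tabulate (punchIn c)
  others≡tabulate-punchIn = filter-tabulate e (λ j → j) (λ eq → eq)
    where
    0≢suc : ∀ {m} {j : Fin m} → Fin.zero ≢ Fin.suc j
    0≢suc ()
    filter-tabulate : ∀ k (h : Fin (suc k) → Fin d) → (∀ {x y} → h x ≡ h y → x ≡ y) → ∀ c →
      List.filter (λ j → ¬? (j Fin.≟ h c)) (tabulate h) ≡ tabulate (h ∘ punchIn c)
    filter-tabulate k h inj Fin.zero =
      ≡.trans (Listₚ.filter-reject (λ j → ¬? (j Fin.≟ h Fin.zero)) (λ z → z ≡.refl))
              (Listₚ.filter-all (λ j → ¬? (j Fin.≟ h Fin.zero))
                                (Allₚ.tabulate⁺ (λ j eq → 0≢suc (≡.sym (inj eq)))))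
    filter-tabulate (suc k) h inj (Fin.suc c) =
      ≡.trans (Listₚ.filter-accept (λ j → ¬? (j Fin.≟ h (Fin.suc c))) (λ eq → 0≢suc (inj eq)))
              (≡.cong (h Fin.zero ∷_)
                      (filter-tabulate k (h ∘ Fin.suc) (λ eq → suc-injective (inj eq)) c))

  length-others : ∀ c → length (others c) ≡ e
  length-others c = ≡.trans (≡.cong length (others≡tabulate-punchIn c)) (Listₚ.length-tabulate (punchIn c))

  others-unique : ∀ c → Unique (others c)
  others-unique c = ≡.subst Unique (≡.sym (others≡tabulate-punchIn c))
                                   (Uniqueₚ.tabulate⁺ (punchIn-injective c _ _))

  others-∌ : ∀ c → All (c ≢_) (others c)
  others-∌ c = ≡.subst (All (c ≢_)) (≡.sym (others≡tabulate-punchIn c))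
                       (Allₚ.tabulate⁺ (λ j eq → punchInᵢ≢i c j (≡.sym eq)))

  siblings : Address d → List (Fin d) → List (Address d)
  siblings = siblingAddrs {d} {n}

  inners : Address d → List (Fin d) → List (Address d)
  inners = innerAddrs {d} {n}

  siblings-++ : ∀ (a b : Address d) cs → siblings (a ++ b) cs ≡ List.map (a ++_) (siblings b cs)
  siblings-++ a b []       = ≡.refl
  siblings-++ a b (c ∷ cs) = begin
    List.map (λ j → (a ++ b) ++ j ∷ []) (others c) ++ siblings ((a ++ b) ++ c ∷ []) cs
      ≡⟨ ≡.cong₂ _++_ (≡.trans (Listₚ.map-cong (λ j → Listₚ.++-assoc a b (j ∷ [])) (others c))
                               (Listₚ.map-∘ (others c)))
                      (≡.trans (≡.cong (λ z → siblings z cs) (Listₚ.++-assoc a b (c ∷ [])))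
                               (siblings-++ a (b ++ c ∷ []) cs)) ⟩
    List.map (a ++_) (List.map (λ j → b ++ j ∷ []) (others c)) ++ List.map (a ++_) (siblings (b ++ c ∷ []) cs)
      ≡⟨ Listₚ.map-++ (a ++_) (List.map (λ j → b ++ j ∷ []) (others c)) (siblings (b ++ c ∷ []) cs) ⟨
    List.map (a ++_) (siblings b (c ∷ cs)) ∎
    where open ≡.≡-Reasoning

  siblings-prefix : ∀ a cs → siblings a cs ≡ List.map (a ++_) (siblings [] cs)
  siblings-prefix a cs = ≡.trans (≡.cong (λ z → siblings z cs) (≡.sym (Listₚ.++-identityʳ a))) (siblings-++ a [] cs)

  siblings-∷ : ∀ c cs → siblings [] (c ∷ cs) ≡ List.map (_∷ []) (others c) ++ List.map (c ∷_) (siblings [] cs)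
  siblings-∷ c cs = ≡.cong (List.map (_∷ []) (others c) ++_) (siblings-++ (c ∷ []) [] cs)

  inners-++ : ∀ (a b : Address d) cs → inners (a ++ b) cs ≡ List.map (a ++_) (inners b cs)
  inners-++ a b []            = ≡.refl
  inners-++ a b (c ∷ [])      = ≡.refl
  inners-++ a b (c ∷ c′ ∷ cs) = ≡.cong₂ _∷_ (Listₚ.++-assoc a b (c ∷ []))
    (≡.trans (≡.cong (λ z → inners z (c′ ∷ cs)) (Listₚ.++-assoc a b (c ∷ []))) (inners-++ a (b ++ c ∷ []) (c′ ∷ cs)))

  inners-prefix : ∀ a cs → inners a cs ≡ List.map (a ++_) (inners [] cs)
  inners-prefix a cs = ≡.trans (≡.cong (λ z → inners z cs) (≡.sym (Listₚ.++-identityʳ a))) (inners-++ a [] cs)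

  -- the inner vertices of a path that starts at a child, seen from that child
  innersFromChild : List (Fin d) → List (Address d)
  innersFromChild []       = []
  innersFromChild (c ∷ cs) = [] ∷ inners [] (c ∷ cs)

  inners-∷ : ∀ c cs → inners [] (c ∷ cs) ≡ List.map (c ∷_) (innersFromChild cs)
  inners-∷ c []        = ≡.refl
  inners-∷ c (c′ ∷ cs) = ≡.cong ((c ∷ []) ∷_) (inners-++ (c ∷ []) [] (c′ ∷ cs))

  length-siblings : ∀ cs → length (siblings [] cs) ≡ length cs ℕ.* e
  length-siblings []       = ≡.refl
  length-siblings (c ∷ cs) = ≡.trans (≡.cong length (siblings-∷ c cs))
    (≡.trans (Listₚ.length-++ (List.map (_∷ []) (others c)))
      (≡.cong₂ ℕ._+_ (≡.trans (Listₚ.length-map _ (others c)) (length-others c))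
                     (≡.trans (Listₚ.length-map _ (siblings [] cs)) (length-siblings cs))))

  zip-prefix : ∀ {A : Set} a (xs : List (Address d)) (ys : List A) →
               zip (List.map (a ++_) xs) ys ≡ prefixAll a (zip xs ys)
  zip-prefix a []       ys       = ≡.refl
  zip-prefix a (x ∷ xs) []       = ≡.refl
  zip-prefix a (x ∷ xs) (y ∷ ys) = ≡.cong ((a ++ x , y) ∷_) (zip-prefix a xs ys)

  NonRoot-zip : ∀ {A : Set} (xs : List (Address d)) (ys : List A) →
                All NonRoot xs → All (NonRoot ∘ proj₁) (zip xs ys)
  NonRoot-zip []       ys       _        = []
  NonRoot-zip (x ∷ xs) []       _        = []
  NonRoot-zip (x ∷ xs) (y ∷ ys) (p ∷ ps) = p ∷ NonRoot-zip xs ys ps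

  NonRoot-siblings : ∀ {A : Set} cs (vs : List A) → All (NonRoot ∘ proj₁) (zip (siblings [] cs) vs)
  NonRoot-siblings []       vs = []
  NonRoot-siblings (c ∷ cs) vs = NonRoot-zip _ vs (≡.subst (All NonRoot) (≡.sym (siblings-∷ c cs))
    (Allₚ.++⁺ (Allₚ.map⁺ (All.universal (λ _ → tt) (others c)))
              (Allₚ.map⁺ (All.universal (λ _ → tt) (siblings [] cs)))))

  NonRoot-inners : ∀ {A : Set} cs (vs : List A) → All (NonRoot ∘ proj₁) (zip (inners [] cs) vs)
  NonRoot-inners []       vs = []
  NonRoot-inners (c ∷ cs) vs = NonRoot-zip _ vs (≡.subst (All NonRoot) (≡.sym (inners-∷ c cs))
    (Allₚ.map⁺ (All.universal (λ _ → tt) (innersFromChild cs))))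

  subtreeAt-++ : ∀ (t : T) a b {u} → subtreeAt t a ≡ just u → subtreeAt t (a ++ b) ≡ subtreeAt u b
  subtreeAt-++ t          []      b ≡.refl = ≡.refl
  subtreeAt-++ (node x f) (c ∷ a) b eq     = subtreeAt-++ (f c) a b eq

  subtreeAt-prefix : ∀ (t : T) a b → Is-just (subtreeAt t (a ++ b)) → Σ T (λ u → subtreeAt t a ≡ just u)
  subtreeAt-prefix t          []      b _ = t , ≡.refl
  subtreeAt-prefix (node x f) (c ∷ a) b v = subtreeAt-prefix (f c) a b v

  siblings-exist : ∀ (u : T) cs → Is-just (subtreeAt u cs) → All (Is-just ∘ subtreeAt u) (siblings [] cs)
  siblings-exist u          []       v = []
  siblings-exist (node x f) (c ∷ cs) v = ≡.subst (All (Is-just ∘ subtreeAt (node x f))) (≡.sym (siblings-∷ c cs))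
    (Allₚ.++⁺ (Allₚ.map⁺ (All.universal (λ _ → MaybeAny.just tt) (others c)))
              (Allₚ.map⁺ (siblings-exist (f c) cs v)))

  permuteSubtrees≡graftAll : ∀ {m} t (ps : Vec (Address d) m) σ →
    permuteSubtrees t ps σ ≡ graftAll t (zip (toList ps) (toList (Vec.map (subtreeAt t ∘ lookup ps) σ)))
  permuteSubtrees≡graftAll {m} t ps σ = begin
    List.foldr (λ s acc → graft acc (lookup ps s) (subtreeAt t (lookup ps (lookup σ s)))) t (allFin m)
      ≡⟨ Listₚ.foldr-map (λ (b , ms) acc → graft acc b ms) entry t (allFin m) ⟨
    graftAll t (List.map entry (allFin m))
      ≡⟨ ≡.cong (graftAll t) (Listₚ.map-tabulate (λ s → s) entry) ⟩
    graftAll t (tabulate entry)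
      ≡⟨ ≡.cong (graftAll t) (Listₚ.tabulate-cong (λ s →
           ≡.cong (lookup ps s ,_) (≡.sym (Vecₚ.lookup-map s (subtreeAt t ∘ lookup ps) σ)))) ⟩
    graftAll t (tabulate (λ s → lookup ps s , lookup (Vec.map (subtreeAt t ∘ lookup ps) σ) s))
      ≡⟨ ≡.cong (graftAll t) (zip-toList ps _) ⟨
    graftAll t (zip (toList ps) (toList (Vec.map (subtreeAt t ∘ lookup ps) σ))) ∎
    where
    open ≡.≡-Reasoning
    entry : Fin m → Address d × Maybe T
    entry s = lookup ps s , subtreeAt t (lookup ps (lookup σ s))
    zip-toList : ∀ {A B : Set} {k} (v : Vec A k) (u : Vec B k) →
                 zip (toList v) (toList u) ≡ tabulate (λ s → lookup v s , lookup u s)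
    zip-toList []      []      = ≡.refl
    zip-toList (x ∷ v) (y ∷ u) = ≡.cong ((x , y) ∷_) (zip-toList v u)

  childTypeCount≡count : ∀ (f : Fin d → T) → childTypeCount f ≡ count (tabulate (rootType ∘ f))
  childTypeCount≡count f = ≡.trans (Vecₚ.tabulate-cong (λ i →
      ≡.trans (≡.cong ℕL.sum (≡.trans (Listₚ.map-tabulate (λ j → j) _)
                                      (≡.sym (Listₚ.map-tabulate (rootType ∘ f) _))))
              (≡.sym (lookup-count (tabulate (rootType ∘ f)) i))))
    (Vecₚ.tabulate∘lookup (count (tabulate (rootType ∘ f))))

  -- The first e sources go to the siblings of the spine child c, the rest further down the spine.
  module SpineStep (c : Fin d) (cs : List (Fin d)) (f : Fin d → T)
                   (srcs : List (Maybe T)) (ρs : List (Fin n)) (len : length (take e srcs) ≡ e) where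

    near far : List (Maybe T)
    near = take e srcs
    far  = drop e srcs

    spineChild : T
    spineChild = retypeAll (graftAll (f c) (zip (siblings [] cs) far)) (zip (innersFromChild cs) ρs)

    children : Fin d → T
    children j = retypeAll (graftAll (f j) (inChild j (zip (siblings [] (c ∷ cs)) srcs)))
                           (inChild j (zip (inners [] (c ∷ cs)) ρs))

    private
      nearEntries farEntries : List (Address d × Maybe T)
      nearEntries = zip (List.map (_∷ []) (others c)) near
      farEntries = prefixAll (c ∷ []) (zip (siblings [] cs) far)

      sources-split : zip (siblings [] (c ∷ cs)) srcs ≡ nearEntries ++ farEntries
      sources-split = ≡.trans (≡.cong₂ zip (siblings-∷ c cs) (≡.sym (Listₚ.take++drop≡id e srcs)))
        (≡.trans (zip-++ (List.map (_∷ []) (others c)) _ near far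
                   (≡.trans (Listₚ.length-map _ (others c)) (≡.trans (length-others c) (≡.sym len))))
                 (≡.cong (nearEntries ++_) (zip-prefix (c ∷ []) (siblings [] cs) far)))

      retypings-shift : zip (inners [] (c ∷ cs)) ρs ≡ prefixAll (c ∷ []) (zip (innersFromChild cs) ρs)
      retypings-shift = ≡.trans (≡.cong (λ z → zip z ρs) (inners-∷ c cs)) (zip-prefix (c ∷ []) (innersFromChild cs) ρs)

    children-spine : children c ≡ spineChild
    children-spine = ≡.cong₂ (λ A B → retypeAll (graftAll (f c) A) B)
      (≡.trans (≡.cong (inChild c) sources-split)
        (≡.trans (inChild-++ c nearEntries farEntries)
                 (≡.cong₂ _++_ (inChild-children-∌ c (others c) near (others-∌ c))
                               (inChild-prefixAll-self c (zip (siblings [] cs) far)))))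
      (≡.trans (≡.cong (inChild c) retypings-shift) (inChild-prefixAll-self c (zip (innersFromChild cs) ρs)))

    children-off-spine : ∀ j → j ≢ c → children j ≡ graftAll (f j) (inChild j nearEntries)
    children-off-spine j j≢c = ≡.cong₂ (λ A B → retypeAll (graftAll (f j) A) B)
      (≡.trans (≡.cong (inChild j) sources-split)
        (≡.trans (inChild-++ j nearEntries farEntries)
          (≡.trans (≡.cong (inChild j nearEntries ++_) (inChild-prefixAll-other j c (zip (siblings [] cs) far) j≢c))
                   (Listₚ.++-identityʳ (inChild j nearEntries)))))
      (≡.trans (≡.cong (inChild j) retypings-shift) (inChild-prefixAll-other j c (zip (innersFromChild cs) ρs) j≢c))

    children-off-spine-read : ∀ {b} {B : Set b} (φ : T → B) (ψ : Maybe T → B) → (∀ s → ψ (just s) ≡ φ s) →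
      All Is-just near → tabulate (φ ∘ children ∘ punchIn c) ≡ List.map ψ near
    children-off-spine-read φ ψ ψ≗φ js = begin
      tabulate (φ ∘ children ∘ punchIn c)
        ≡⟨ Listₚ.tabulate-cong (λ j → ≡.cong φ (children-off-spine (punchIn c j) (punchInᵢ≢i c j))) ⟩
      tabulate (φ ∘ offSpine ∘ punchIn c)
        ≡⟨ Listₚ.map-tabulate (punchIn c) (φ ∘ offSpine) ⟨
      List.map (φ ∘ offSpine) (tabulate (punchIn c))
        ≡⟨ ≡.cong (List.map (φ ∘ offSpine)) (others≡tabulate-punchIn c) ⟨
      List.map (φ ∘ offSpine) (others c)
        ≡⟨ graftAll-children f φ ψ ψ≗φ (others c) near (others-unique c)
             (≡.trans (length-others c) (≡.sym len)) js ⟩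
      List.map ψ near ∎
      where
      open ≡.≡-Reasoning
      offSpine : Fin d → T
      offSpine j = graftAll (f j) (inChild j nearEntries)

-- Permutations as distinct words

distinct : ∀ {k m} → Vec (Fin k) m → Bool
distinct v = does (UniqueDec.unique? Fin._≟_ (toList v))

distinct-∷-∈ : ∀ {k m} (i : Fin k) (τ : Vec (Fin k) m) → i ∈ toList τ → distinct (i ∷ τ) ≡ false
distinct-∷-∈ i τ i∈τ = dec-false (UniqueDec.unique? Fin._≟_ (i ∷ toList τ))
                               (λ { (i∉τ ∷ _) → Allₚ.All¬⇒¬Any i∉τ i∈τ })

distinct-punchIn : ∀ {k m} (i : Fin (suc k)) (u : Vec (Fin k) m) → distinct (i ∷ Vec.map (punchIn i) u) ≡ distinct u
distinct-punchIn i u = does-⇔ (mk⇔ to from) (UniqueDec.unique? Fin._≟_ (i ∷ toList (Vec.map (punchIn i) u)))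
                                          (UniqueDec.unique? Fin._≟_ (toList u))
  where
  toList-map : toList (Vec.map (punchIn i) u) ≡ List.map (punchIn i) (toList u)
  toList-map = Vecₚ.toList-map (punchIn i) u
  to : Unique (i ∷ toList (Vec.map (punchIn i) u)) → Unique (toList u)
  to (_ ∷ uq) = Uniqueₚ.map⁻ (≡.subst Unique toList-map uq)
  from : Unique (toList u) → Unique (i ∷ toList (Vec.map (punchIn i) u))
  from uq = ≡.subst (All (i ≢_)) (≡.sym toList-map)
                    (Allₚ.map⁺ (All.universal (λ j eq → punchInᵢ≢i i j (≡.sym eq)) (toList u)))
          ∷ ≡.subst Unique (≡.sym toList-map) (Uniqueₚ.map⁺ (punchIn-injective i _ _) uq)

-- Finite sums in a commutative ring

module Sums {ℓ₁ ℓ₂ : Level} (R : CommutativeRing ℓ₁ ℓ₂) where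

  open CommutativeRing R
  open import Algebra.Properties.Semiring.Sum semiring public
  open import Algebra.Properties.CommutativeSemigroup *-commutativeSemigroup public
    using () renaming (interchange to *-interchange; x∙yz≈y∙xz to *-left-comm)
  open import Algebra.Properties.CommutativeMonoid.Sum *-commutativeMonoid public
    using () renaming (sum to product; sum-cong-≋ to product-cong; sum-remove to product-remove)
  open import Relation.Binary.Reasoning.Setoid setoid

  when : Bool → Carrier → Carrier
  when b x = if b then x else 0#

  when-cong : ∀ b {x y} → x ≈ y → when b x ≈ when b y
  when-cong true  x≈y = x≈y
  when-cong false _   = refl

  when-zero : ∀ b → when b 0# ≈ 0#
  when-zero true  = refl
  when-zero false = refl

  when-*ˡ : ∀ b x y → when b x * y ≈ when b (x * y)
  when-*ˡ true  x y = refl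
  when-*ˡ false x y = zeroˡ y

  when-*ʳ : ∀ b x y → x * when b y ≈ when b (x * y)
  when-*ʳ true  x y = refl
  when-*ʳ false x y = zeroʳ x

  when-comm : ∀ a b x → when a (when b x) ≈ when b (when a x)
  when-comm true  b     x = refl
  when-comm false true  x = refl
  when-comm false false x = refl

  when-∧ : ∀ a b x → when (a ∧ b) x ≈ when a (when b x)
  when-∧ true  b x = refl
  when-∧ false b x = refl

  when-≡ : ∀ {A : Set} (_≟_ : (x y : A) → Dec (x ≡ y)) x y (φ : A → Carrier) →
           when (does (x ≟ y)) (φ x) ≈ when (does (x ≟ y)) (φ y)
  when-≡ _≟_ x y φ with x ≟ y
  ... | yes ≡.refl = refl
  ... | no  _      = refl

  ∑-zero : ∀ k {f : Fin k → Carrier} → (∀ j → f j ≈ 0#) → ∑[ j < k ] f j ≈ 0#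
  ∑-zero k f≈0 = trans (sum-cong-≋ f≈0) (sum-replicate-zero k)

  ∑-when : ∀ k b (f : Fin k → Carrier) → when b (∑[ j < k ] f j) ≈ ∑[ j < k ] when b (f j)
  ∑-when k true  f = refl
  ∑-when k false f = sym (∑-zero k (λ _ → refl))

  ∑-δ : ∀ k i (f : Fin k → Carrier) → ∑[ j < k ] when (does (j Fin.≟ i)) (f j) ≈ f i
  ∑-δ (suc k) i f = begin
    ∑[ j < suc k ] when (does (j Fin.≟ i)) (f j)
      ≈⟨ sum-remove {i = i} (λ j → when (does (j Fin.≟ i)) (f j)) ⟩
    when (does (i Fin.≟ i)) (f i) + ∑[ j < k ] when (does (punchIn i j Fin.≟ i)) (f (punchIn i j))
      ≈⟨ +-cong (reflexive (≡.cong (λ b → when b (f i)) (dec-true (i Fin.≟ i) ≡.refl)))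
                (∑-zero k (λ j → reflexive (≡.cong (λ b → when b (f (punchIn i j))) (dec-false (punchIn i j Fin.≟ i) (punchInᵢ≢i i j))))) ⟩
    f i + 0#
      ≈⟨ +-identityʳ (f i) ⟩
    f i ∎

  ∑-δ′ : ∀ k i (f : Fin k → Carrier) → ∑[ j < k ] when (does (i Fin.≟ j)) (f j) ≈ f i
  ∑-δ′ k i f = trans (sum-cong-≋ (λ j → reflexive (≡.cong (λ b → when b (f j))
                       (does-⇔ (mk⇔ ≡.sym ≡.sym) (i Fin.≟ j) (j Fin.≟ i)))))
                     (∑-δ k i f)

  sumR-cong : ∀ {A : Set} (xs : List A) {f g : A → Carrier} → (∀ x → f x ≈ g x) →
              sumR R (List.map f xs) ≈ sumR R (List.map g xs)
  sumR-cong []       f≈g = refl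
  sumR-cong (x ∷ xs) f≈g = +-cong (f≈g x) (sumR-cong xs f≈g)

  sumR-zero : ∀ {A : Set} (xs : List A) {f : A → Carrier} → (∀ x → f x ≈ 0#) → sumR R (List.map f xs) ≈ 0#
  sumR-zero []       f≈0 = refl
  sumR-zero (x ∷ xs) f≈0 = trans (+-cong (f≈0 x) (sumR-zero xs f≈0)) (+-identityˡ 0#)

  *-distribˡ-sumR : ∀ {A : Set} (xs : List A) x (f : A → Carrier) →
                    x * sumR R (List.map f xs) ≈ sumR R (List.map (λ a → x * f a) xs)
  *-distribˡ-sumR []       x f = zeroʳ x
  *-distribˡ-sumR (a ∷ xs) x f = trans (distribˡ x _ _) (+-congˡ (*-distribˡ-sumR xs x f))

  sumR-++ : ∀ {A : Set} (xs ys : List A) (f : A → Carrier) →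
            sumR R (List.map f (xs ++ ys)) ≈ sumR R (List.map f xs) + sumR R (List.map f ys)
  sumR-++ []       ys f = sym (+-identityˡ _)
  sumR-++ (x ∷ xs) ys f = trans (+-congˡ (sumR-++ xs ys f)) (sym (+-assoc _ _ _))

  sumR-concatMap : ∀ {A B : Set} (xs : List A) (g : A → List B) (f : B → Carrier) →
    sumR R (List.map f (concatMap g xs)) ≈ sumR R (List.map (λ x → sumR R (List.map f (g x))) xs)
  sumR-concatMap []       g f = refl
  sumR-concatMap (x ∷ xs) g f = trans (sumR-++ (g x) (concatMap g xs) f) (+-congˡ (sumR-concatMap xs g f))

  sumR-map-∘ : ∀ {A B : Set} (xs : List A) (g : A → B) (f : B → Carrier) →
               sumR R (List.map f (List.map g xs)) ≈ sumR R (List.map (f ∘ g) xs)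
  sumR-map-∘ xs g f = reflexive (≡.cong (sumR R) (≡.sym (Listₚ.map-∘ xs)))

  sumR-filter : ∀ {A : Set} {P : A → Set} (P? : ∀ x → Dec (P x)) (xs : List A) (f : A → Carrier) →
    sumR R (List.map f (List.filter P? xs)) ≈ sumR R (List.map (λ x → when (does (P? x)) (f x)) xs)
  sumR-filter P? []       f = refl
  sumR-filter P? (x ∷ xs) f with does (P? x)
  ... | true  = +-congˡ (sumR-filter P? xs f)
  ... | false = trans (sumR-filter P? xs f) (sym (+-identityˡ _))

  sumR-when : ∀ {A : Set} (xs : List A) b (f : A → Carrier) →
              sumR R (List.map (λ x → when b (f x)) xs) ≈ when b (sumR R (List.map f xs))
  sumR-when xs true  f = refl
  sumR-when xs false f = sumR-zero xs (λ _ → refl)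

  sumR-allFin : ∀ k (f : Fin k → Carrier) → sumR R (List.map f (allFin k)) ≈ ∑[ j < k ] f j
  sumR-allFin k f = reflexive (≡.trans (≡.cong (sumR R) (Listₚ.map-tabulate (λ j → j) f)) (sumR-tabulate k f))
    where
    sumR-tabulate : ∀ k (f : Fin k → Carrier) → sumR R (tabulate f) ≡ ∑[ j < k ] f j
    sumR-tabulate zero    f = ≡.refl
    sumR-tabulate (suc k) f = ≡.cong (f Fin.zero +_) (sumR-tabulate k (f ∘ Fin.suc))

  prodR-tabulate : ∀ k (f : Fin k → Carrier) → prodR R (tabulate f) ≡ product f
  prodR-tabulate zero    f = ≡.refl
  prodR-tabulate (suc k) f = ≡.cong (f Fin.zero *_) (prodR-tabulate k (f ∘ Fin.suc))

  prodR-allFin : ∀ k (f : Fin k → Carrier) → prodR R (List.map f (allFin k)) ≡ product f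
  prodR-allFin k f = ≡.trans (≡.cong (prodR R) (Listₚ.map-tabulate (λ j → j) f)) (prodR-tabulate k f)

  prodR-++ : ∀ (xs ys : List Carrier) → prodR R (xs ++ ys) ≈ prodR R xs * prodR R ys
  prodR-++ []       ys = sym (*-identityˡ _)
  prodR-++ (x ∷ xs) ys = trans (*-congˡ (prodR-++ xs ys)) (sym (*-assoc _ _ _))

  sumWords : (k m : ℕ) → (Vec (Fin k) m → Carrier) → Carrier
  sumWords k zero    F = F []
  sumWords k (suc m) F = ∑[ i < k ] sumWords k m (F ∘ (i ∷_))

  sumWords-cong : ∀ k m {F G : Vec (Fin k) m → Carrier} → (∀ v → F v ≈ G v) → sumWords k m F ≈ sumWords k m G
  sumWords-cong k zero    F≈G = F≈G []
  sumWords-cong k (suc m) F≈G = sum-cong-≋ (λ i → sumWords-cong k m (F≈G ∘ (i ∷_)))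

  sumWords-zero : ∀ k m {F : Vec (Fin k) m → Carrier} → (∀ v → F v ≈ 0#) → sumWords k m F ≈ 0#
  sumWords-zero k zero    F≈0 = F≈0 []
  sumWords-zero k (suc m) F≈0 = ∑-zero k (λ i → sumWords-zero k m (F≈0 ∘ (i ∷_)))

  sumWords-+ : ∀ k m (F G : Vec (Fin k) m → Carrier) →
               sumWords k m (λ v → F v + G v) ≈ sumWords k m F + sumWords k m G
  sumWords-+ k zero    F G = refl
  sumWords-+ k (suc m) F G = trans (sum-cong-≋ (λ i → sumWords-+ k m (F ∘ (i ∷_)) (G ∘ (i ∷_))))
                                   (∑-distrib-+ (λ i → sumWords k m (F ∘ (i ∷_))) (λ i → sumWords k m (G ∘ (i ∷_))))

  *-distribˡ-sumWords : ∀ k m x (F : Vec (Fin k) m → Carrier) → x * sumWords k m F ≈ sumWords k m (λ v → x * F v)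
  *-distribˡ-sumWords k zero    x F = refl
  *-distribˡ-sumWords k (suc m) x F =
    trans (*-distribˡ-sum x (λ i → sumWords k m (F ∘ (i ∷_)))) (sum-cong-≋ (λ i → *-distribˡ-sumWords k m x (F ∘ (i ∷_))))

  *-distribʳ-sumWords : ∀ k m x (F : Vec (Fin k) m → Carrier) → sumWords k m F * x ≈ sumWords k m (λ v → F v * x)
  *-distribʳ-sumWords k zero    x F = refl
  *-distribʳ-sumWords k (suc m) x F =
    trans (*-distribʳ-sum x (λ i → sumWords k m (F ∘ (i ∷_)))) (sum-cong-≋ (λ i → *-distribʳ-sumWords k m x (F ∘ (i ∷_))))

  sumWords-∑ : ∀ k m l (F : Vec (Fin k) m → Fin l → Carrier) →
               sumWords k m (λ v → ∑[ j < l ] F v j) ≈ ∑[ j < l ] sumWords k m (λ v → F v j)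
  sumWords-∑ k zero    l F = refl
  sumWords-∑ k (suc m) l F =
    trans (sum-cong-≋ (λ i → sumWords-∑ k m l (F ∘ (i ∷_)))) (∑-comm (λ i j → sumWords k m (λ v → F (i ∷ v) j)))

  sumWords-++ : ∀ k a b (F : Vec (Fin k) (a ℕ.+ b) → Carrier) →
                sumWords k (a ℕ.+ b) F ≈ sumWords k a (λ u → sumWords k b (λ v → F (u Vec.++ v)))
  sumWords-++ k zero    b F = refl
  sumWords-++ k (suc a) b F = sum-cong-≋ (λ i → sumWords-++ k a b (F ∘ (i ∷_)))

  sumWords-cast : ∀ k {m m′} → m ≡ m′ → (F : List (Fin k) → Carrier) →
                  sumWords k m (F ∘ toList) ≈ sumWords k m′ (F ∘ toList)
  sumWords-cast k ≡.refl F = refl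

  sumR-allVecs : ∀ k m (F : Vec (Fin k) m → Carrier) → sumR R (List.map F (allVecs k m)) ≈ sumWords k m F
  sumR-allVecs k zero    F = +-identityʳ _
  sumR-allVecs k (suc m) F = begin
    sumR R (List.map F (concatMap (λ i → List.map (i ∷_) (allVecs k m)) (allFin k)))
      ≈⟨ sumR-concatMap (allFin k) _ F ⟩
    sumR R (List.map (λ i → sumR R (List.map F (List.map (i ∷_) (allVecs k m)))) (allFin k))
      ≈⟨ sumR-cong (allFin k) (λ i → trans (sumR-map-∘ (allVecs k m) (i ∷_) F) (sumR-allVecs k m _)) ⟩
    sumR R (List.map (λ i → sumWords k m (F ∘ (i ∷_))) (allFin k))
      ≈⟨ sumR-allFin k _ ⟩
    sumWords k (suc m) F ∎

  sumR-sumWords : ∀ {A : Set} (xs : List A) k m (F : A → Vec (Fin k) m → Carrier) →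
    sumR R (List.map (λ x → sumWords k m (F x)) xs) ≈ sumWords k m (λ v → sumR R (List.map (λ x → F x v) xs))
  sumR-sumWords []       k m F = sym (sumWords-zero k m (λ _ → refl))
  sumR-sumWords (x ∷ xs) k m F = trans (+-congˡ (sumR-sumWords xs k m F)) (sym (sumWords-+ k m _ _))

  sumPerms : (m : ℕ) → (Vec (Fin m) m → Carrier) → Carrier
  sumPerms m h = sumWords m m (λ u → when (distinct u) (h u))

  sumPerms-cong : ∀ m {h h′ : Vec (Fin m) m → Carrier} → (∀ σ → h σ ≈ h′ σ) → sumPerms m h ≈ sumPerms m h′
  sumPerms-cong m h≈h′ = sumWords-cong m m (λ σ → when-cong (distinct σ) (h≈h′ σ))

  *-distribˡ-sumPerms : ∀ m x (h : Vec (Fin m) m → Carrier) → x * sumPerms m h ≈ sumPerms m (λ σ → x * h σ)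
  *-distribˡ-sumPerms m x h = trans (*-distribˡ-sumWords m m x _) (sumWords-cong m m (λ σ → when-*ʳ (distinct σ) x (h σ)))

  sumR-perms : ∀ m (h : Vec (Fin m) m → Carrier) → sumR R (List.map h (perms m)) ≈ sumPerms m h
  sumR-perms m h = trans (sumR-filter (λ v → UniqueDec.unique? Fin._≟_ (toList v)) (allVecs m m) h)
                         (sumR-allVecs m m _)

  sumWords-avoiding : ∀ k q i (F : Vec (Fin (suc k)) q → Carrier) → (∀ τ → i ∈ toList τ → F τ ≈ 0#) →
                      sumWords (suc k) q F ≈ sumWords k q (F ∘ Vec.map (punchIn i))
  sumWords-avoiding k zero    i F F≈0 = refl
  sumWords-avoiding k (suc q) i F F≈0 = begin
    ∑[ j < suc k ] sumWords (suc k) q (F ∘ (j ∷_))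
      ≈⟨ sum-remove {i = i} (λ j → sumWords (suc k) q (F ∘ (j ∷_))) ⟩
    sumWords (suc k) q (F ∘ (i ∷_)) + ∑[ j < k ] sumWords (suc k) q (F ∘ (punchIn i j ∷_))
      ≈⟨ +-cong (sumWords-zero (suc k) q (λ v → F≈0 (i ∷ v) (here ≡.refl)))
                (sum-cong-≋ (λ j → sumWords-avoiding k q i _ (λ τ i∈τ → F≈0 (punchIn i j ∷ τ) (there i∈τ)))) ⟩
    0# + ∑[ j < k ] sumWords k q (λ u → F (punchIn i j ∷ Vec.map (punchIn i) u))
      ≈⟨ +-identityˡ _ ⟩
    sumWords k (suc q) (F ∘ Vec.map (punchIn i)) ∎

  sumPerms-suc : ∀ m (h : Vec (Fin (suc m)) (suc m) → Carrier) →
                 sumPerms (suc m) h ≈ ∑[ i < suc m ] sumPerms m (λ u → h (i ∷ Vec.map (punchIn i) u))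
  sumPerms-suc m h = sum-cong-≋ (λ i → begin
    sumWords (suc m) m (λ τ → when (distinct (i ∷ τ)) (h (i ∷ τ)))
      ≈⟨ sumWords-avoiding m m i _ (λ τ i∈τ → reflexive (≡.cong (λ b → when b (h (i ∷ τ))) (distinct-∷-∈ i τ i∈τ))) ⟩
    sumWords m m (λ u → when (distinct (i ∷ Vec.map (punchIn i) u)) (h (i ∷ Vec.map (punchIn i) u)))
      ≈⟨ sumWords-cong m m (λ u → reflexive (≡.cong (λ b → when b (h (i ∷ Vec.map (punchIn i) u))) (distinct-punchIn i u))) ⟩
    sumPerms m (λ u → h (i ∷ Vec.map (punchIn i) u)) ∎)

  ℕ→R-+ : ∀ a b → ℕ→R R (a ℕ.+ b) ≈ ℕ→R R a + ℕ→R R b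
  ℕ→R-+ zero    b = sym (+-identityˡ _)
  ℕ→R-+ (suc a) b = trans (+-congˡ (ℕ→R-+ a b)) (sym (+-assoc _ _ _))

  ℕ→R-* : ∀ a b → ℕ→R R (a ℕ.* b) ≈ ℕ→R R a * ℕ→R R b
  ℕ→R-* zero    b = sym (zeroˡ _)
  ℕ→R-* (suc a) b = begin
    ℕ→R R (b ℕ.+ a ℕ.* b)                ≈⟨ ℕ→R-+ b (a ℕ.* b) ⟩
    ℕ→R R b + ℕ→R R (a ℕ.* b)            ≈⟨ +-cong (sym (*-identityˡ _)) (ℕ→R-* a b) ⟩
    1# * ℕ→R R b + ℕ→R R a * ℕ→R R b     ≈⟨ distribʳ _ _ _ ⟨
    (1# + ℕ→R R a) * ℕ→R R b             ∎

  module _ {n : ℕ} where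

    sumWordsOfCount : (m : ℕ) → Vec ℕ n → (List (Fin n) → Carrier) → Carrier
    sumWordsOfCount m γ G = sumWords n m (λ s → when (does (count (toList s) ≟ᵥ γ)) (G (toList s)))

    sumWordsOfCount-∷-absent : ∀ m (β : Vec ℕ n) c (X : List (Fin n) → Carrier) → lookup β c ≡ 0 →
      sumWords n m (λ s → when (does (count (c ∷ toList s) ≟ᵥ β)) (X (toList s))) ≈ 0#
    sumWordsOfCount-∷-absent m β c X βc≡0 = sumWords-zero n m (λ s →
      reflexive (≡.cong (λ b → when b (X (toList s))) (dec-false (count (c ∷ toList s) ≟ᵥ β) (λ eq →
        ℕₚ.0≢1+n (≡.trans (≡.sym βc≡0) (≡.trans (≡.cong (λ z → lookup z c) (≡.sym eq))
                                                 (Vecₚ.lookup∘updateAt c (count (toList s)))))))))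

    sumWordsOfCount-∷ : ∀ m (β : Vec ℕ n) c {k} (X : List (Fin n) → Carrier) → lookup β c ≡ suc k →
      sumWords n m (λ s → when (does (count (c ∷ toList s) ≟ᵥ β)) (X (toList s)))
      ≈ sumWordsOfCount m (updateAt β c ℕ.pred) X
    sumWordsOfCount-∷ m β c X βc≡1+k = sumWords-cong n m (λ s → reflexive (≡.cong (λ b → when b (X (toList s)))
      (does-⇔ (mk⇔ (λ eq → ≡.trans (≡.sym (updateAt-pred-suc (count (toList s)) c))
                                   (≡.cong (λ z → updateAt z c ℕ.pred) eq))
                   (λ eq → ≡.trans (≡.cong (λ z → updateAt z c suc) eq) (updateAt-suc-pred β c βc≡1+k)))
              (count (c ∷ toList s) ≟ᵥ β) (count (toList s) ≟ᵥ updateAt β c ℕ.pred))))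

    ∑-by-count : ∀ k (t : Fin k → Fin n) (F : Fin n → Carrier) →
      ∑[ i < k ] F (t i) ≈ ∑[ c < n ] (ℕ→R R (lookup (count (tabulate t)) c) * F c)
    ∑-by-count zero    t F = sym (∑-zero n (λ c →
      trans (*-congʳ (reflexive (≡.cong (ℕ→R R) (Vecₚ.lookup-replicate c 0)))) (zeroˡ _)))
    ∑-by-count (suc k) t F = begin
      F (t Fin.zero) + ∑[ i < k ] F (t (Fin.suc i))
        ≈⟨ +-cong (sym (∑-δ n (t Fin.zero) F)) (∑-by-count k (t ∘ Fin.suc) F) ⟩
      ∑[ c < n ] when (does (c Fin.≟ t Fin.zero)) (F c) + ∑[ c < n ] (ℕ→R R (lookup X c) * F c)
        ≈⟨ ∑-distrib-+ (λ c → when (does (c Fin.≟ t Fin.zero)) (F c)) (λ c → ℕ→R R (lookup X c) * F c) ⟨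
      ∑[ c < n ] (when (does (c Fin.≟ t Fin.zero)) (F c) + ℕ→R R (lookup X c) * F c)
        ≈⟨ sum-cong-≋ pointwise ⟩
      ∑[ c < n ] (ℕ→R R (lookup (updateAt X (t Fin.zero) suc) c) * F c) ∎
      where
      X = count (tabulate (t ∘ Fin.suc))
      pointwise : ∀ c → when (does (c Fin.≟ t Fin.zero)) (F c) + ℕ→R R (lookup X c) * F c
                      ≈ ℕ→R R (lookup (updateAt X (t Fin.zero) suc) c) * F c
      pointwise c with c Fin.≟ t Fin.zero
      ... | yes ≡.refl = begin
        F c + ℕ→R R (lookup X c) * F c          ≈⟨ +-congʳ (*-identityˡ _) ⟨
        1# * F c + ℕ→R R (lookup X c) * F c     ≈⟨ distribʳ _ _ _ ⟨
        ℕ→R R (suc (lookup X c)) * F c          ≈⟨ *-congʳ (reflexive (≡.cong (ℕ→R R) (Vecₚ.lookup∘updateAt c X))) ⟨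
        ℕ→R R (lookup (updateAt X c suc) c) * F c ∎
      ... | no c≢t = trans (+-identityˡ _)
        (*-congʳ (reflexive (≡.cong (ℕ→R R) (≡.sym (Vecₚ.lookup∘updateAt′ c (t Fin.zero) c≢t X)))))

    startingWith : ∀ m → Vec ℕ n → (List (Fin n) → Carrier) → Fin n → Carrier
    startingWith m γ G c = sumWords n m (λ s → when (does (count (c ∷ toList s) ≟ᵥ γ)) (G (c ∷ toList s)))

    startingWith-factorial : ∀ m γ G c →
      ℕ→R R (lookup γ c) * (ℕ→R R (updateAt γ c ℕ.pred !ₘ) * startingWith m γ G c) ≈ ℕ→R R (γ !ₘ) * startingWith m γ G c
    startingWith-factorial m γ G c with lookup γ c in γc
    ... | zero  = trans (zeroˡ _) (sym (trans (*-congˡ (sumWordsOfCount-∷-absent m γ c (G ∘ (c ∷_)) γc)) (zeroʳ _)))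
    ... | suc k = begin
      ℕ→R R (suc k) * (ℕ→R R (updateAt γ c ℕ.pred !ₘ) * B)  ≈⟨ *-assoc _ _ _ ⟨
      ℕ→R R (suc k) * ℕ→R R (updateAt γ c ℕ.pred !ₘ) * B    ≈⟨ *-congʳ (ℕ→R-* (suc k) (updateAt γ c ℕ.pred !ₘ)) ⟨
      ℕ→R R (suc k ℕ.* updateAt γ c ℕ.pred !ₘ) * B          ≈⟨ *-congʳ (reflexive (≡.cong (ℕ→R R) (!ₘ-updateAt-pred γ c γc))) ⟨
      ℕ→R R (γ !ₘ) * B                                     ∎
      where B = startingWith m γ G c

    arrangements : ∀ m → (Fin m → Fin n) → (Fin m → Carrier) → (List (Fin n) → Carrier) → Carrier
    arrangements m tF wF G = sumPerms m (λ σ → G (toList (Vec.map tF σ)) * prodR R (toList (Vec.map wF σ)))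

    arrangements-first : ∀ m (tF : Fin (suc m) → Fin n) (wF : Fin (suc m) → Carrier) (G : List (Fin n) → Carrier) i →
      sumPerms m (λ u → G (toList (Vec.map tF (i ∷ Vec.map (punchIn i) u))) * prodR R (toList (Vec.map wF (i ∷ Vec.map (punchIn i) u))))
      ≈ wF i * arrangements m (tF ∘ punchIn i) (wF ∘ punchIn i) (G ∘ (tF i ∷_))
    arrangements-first m tF wF G i = trans (sumPerms-cong m (λ u → begin
      G (tF i ∷ toList (Vec.map tF (Vec.map (punchIn i) u))) * (wF i * prodR R (toList (Vec.map wF (Vec.map (punchIn i) u))))
        ≈⟨ *-cong (reflexive (≡.cong (λ z → G (tF i ∷ toList z)) (≡.sym (Vecₚ.map-∘ tF (punchIn i) u))))
                  (*-congˡ (reflexive (≡.cong (λ z → prodR R (toList z)) (≡.sym (Vecₚ.map-∘ wF (punchIn i) u))))) ⟩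
      G (tF i ∷ toList (Vec.map (tF ∘ punchIn i) u)) * (wF i * prodR R (toList (Vec.map (wF ∘ punchIn i) u)))
        ≈⟨ *-left-comm _ _ _ ⟩
      wF i * (G (tF i ∷ toList (Vec.map (tF ∘ punchIn i) u)) * prodR R (toList (Vec.map (wF ∘ punchIn i) u))) ∎))
      (sym (*-distribˡ-sumPerms m (wF i) (λ u → G (tF i ∷ toList (Vec.map (tF ∘ punchIn i) u)) * prodR R (toList (Vec.map (wF ∘ punchIn i) u)))))

    -- Rearranging m labelled items of types tF and weights wF in all ways sees every type word of
    -- the same content γ exactly γ! times.
    arrangements-count : ∀ m (tF : Fin m → Fin n) (wF : Fin m → Carrier) (G : List (Fin n) → Carrier) →
      arrangements m tF wF G ≈ (ℕ→R R (count (tabulate tF) !ₘ) * product wF) * sumWordsOfCount m (count (tabulate tF)) G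
    arrangements-count zero tF wF G = begin
      G [] * 1#  ≈⟨ *-identityʳ _ ⟩
      G []       ≈⟨ *-identityˡ _ ⟨
      1# * G []
        ≈⟨ *-cong (trans (*-identityʳ _) (trans (reflexive (≡.cong (ℕ→R R) (!ₘ-replicate-0 n))) (+-identityʳ 1#)))
                  (reflexive (≡.cong (λ b → when b (G [])) (dec-true (γ ≟ᵥ γ) ≡.refl))) ⟨
      (ℕ→R R (γ !ₘ) * 1#) * when (does (γ ≟ᵥ γ)) (G []) ∎
      where γ = Vec.replicate n 0
    arrangements-count (suc m) tF wF G = begin
      arrangements (suc m) tF wF G
        ≈⟨ sumPerms-suc m (λ σ → G (toList (Vec.map tF σ)) * prodR R (toList (Vec.map wF σ))) ⟩
      ∑[ i < suc m ] sumPerms m (λ u → G (toList (Vec.map tF (i ∷ Vec.map (punchIn i) u)))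
                                        * prodR R (toList (Vec.map wF (i ∷ Vec.map (punchIn i) u))))
        ≈⟨ sum-cong-≋ first-item ⟩
      ∑[ i < suc m ] (product wF * A (tF i))
        ≈⟨ *-distribˡ-sum (product wF) (A ∘ tF) ⟨
      product wF * ∑[ i < suc m ] A (tF i)
        ≈⟨ *-congˡ (trans (∑-by-count (suc m) tF A) (sum-cong-≋ (startingWith-factorial m γ G))) ⟩
      product wF * ∑[ c < n ] (ℕ→R R (γ !ₘ) * startingWith m γ G c)
        ≈⟨ *-congˡ (*-distribˡ-sum (ℕ→R R (γ !ₘ)) (startingWith m γ G)) ⟨
      product wF * (ℕ→R R (γ !ₘ) * sumWordsOfCount (suc m) γ G)
        ≈⟨ trans (sym (*-assoc _ _ _)) (*-congʳ (*-comm _ _)) ⟩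
      ℕ→R R (γ !ₘ) * product wF * sumWordsOfCount (suc m) γ G ∎
      where
      γ = count (tabulate tF)
      A : Fin n → Carrier
      A c = ℕ→R R (updateAt γ c ℕ.pred !ₘ) * startingWith m γ G c
      first-item : ∀ i → sumPerms m (λ u → G (toList (Vec.map tF (i ∷ Vec.map (punchIn i) u)))
                                           * prodR R (toList (Vec.map wF (i ∷ Vec.map (punchIn i) u))))
                         ≈ product wF * A (tF i)
      first-item i = begin
        _ ≈⟨ arrangements-first m tF wF G i ⟩
        wF i * arrangements m (tF ∘ punchIn i) (wF ∘ punchIn i) (G ∘ (tF i ∷_))
          ≈⟨ *-congˡ (arrangements-count m (tF ∘ punchIn i) (wF ∘ punchIn i) (G ∘ (tF i ∷_))) ⟩
        wF i * ((ℕ→R R (γ′ !ₘ) * product (wF ∘ punchIn i)) * sumWordsOfCount m γ′ (G ∘ (tF i ∷_)))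
          ≈⟨ rearrange _ _ _ _ ⟩
        (wF i * product (wF ∘ punchIn i)) * (ℕ→R R (γ′ !ₘ) * sumWordsOfCount m γ′ (G ∘ (tF i ∷_)))
          ≈⟨ *-cong (sym (product-remove {i = i} wF))
                    (*-cong (reflexive (≡.cong (λ z → ℕ→R R (z !ₘ)) γ′≡))
                            (trans (reflexive (≡.cong (λ z → sumWordsOfCount m z (G ∘ (tF i ∷_))) γ′≡))
                                   (sym (sumWordsOfCount-∷ m γ (tF i) (G ∘ (tF i ∷_)) (lookup-count-tabulate m tF i))))) ⟩
        product wF * A (tF i) ∎
        where
        γ′ = count (tabulate (tF ∘ punchIn i))
        γ′≡ : γ′ ≡ updateAt γ (tF i) ℕ.pred
        γ′≡ = count-tabulate-punchIn-pred m tF i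
        rearrange : ∀ x γ! p s → x * ((γ! * p) * s) ≈ (x * p) * (γ! * s)
        rearrange = solve 4 (λ x γ! p s → x ⊙ ((γ! ⊙ p) ⊙ s) ⊜ (x ⊙ p) ⊙ (γ! ⊙ s)) refl
          where open import Algebra.Solver.CommutativeMonoid *-commutativeMonoid using (solve; _⊜_) renaming (_⊕_ to _⊙_)

-- Powers of the Jacobian as sums over words

module JacobianWords {ℓ₁ ℓ₂ : Level} (R : CommutativeRing ℓ₁ ℓ₂) (F : IsCharZeroField R) (n : ℕ) where

  open CommutativeRing R
  open IsCharZeroField F
  open Sums R
  open import Algebra.Definitions.RawSemiring (Semiring.rawSemiring semiring) using (_^_)
  open import Relation.Binary.Reasoning.Setoid setoid

  sumUpTo : ℕ → (ℕ → Carrier) → Carrier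
  sumUpTo zero    φ = 0#
  sumUpTo (suc k) φ = φ 0 + sumUpTo k (φ ∘ suc)

  sumR-applyUpTo : ∀ k (f : ℕ → ℕ) (φ : ℕ → Carrier) → sumR R (List.map φ (List.applyUpTo f k)) ≈ sumUpTo k (φ ∘ f)
  sumR-applyUpTo zero    f φ = refl
  sumR-applyUpTo (suc k) f φ = +-congˡ (sumR-applyUpTo k (f ∘ suc) φ)

  sumUpTo-δ : ∀ g x y X → sumUpTo (suc g) (λ b → when (does (x ℕ.≟ b)) (when (does (y ℕ.≟ g ∸ b)) X))
                          ≈ when (does (x ℕ.+ y ℕ.≟ g)) X
  sumUpTo-δ g       zero    y X = trans (+-congˡ (sumUpTo-zero g)) (+-identityʳ _)
    where
    sumUpTo-zero : ∀ k → sumUpTo k (λ _ → 0#) ≈ 0#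
    sumUpTo-zero zero    = refl
    sumUpTo-zero (suc k) = trans (+-identityˡ _) (sumUpTo-zero k)
  sumUpTo-δ zero    (suc x) y X = +-identityˡ _
  sumUpTo-δ (suc g) (suc x) y X = trans (+-identityˡ _) (sumUpTo-δ g x y X)

  below-δ : ∀ {k} (γ x y : Vec ℕ k) X →
    sumR R (List.map (λ β → when (does (x ≟ᵥ β)) (when (does (y ≟ᵥ Vec.zipWith _∸_ γ β)) X)) (below γ))
    ≈ when (does (Vec.zipWith ℕ._+_ x y ≟ᵥ γ)) X
  below-δ []      []      []      X = +-identityʳ _
  below-δ (g ∷ γ) (x ∷ xs) (y ∷ ys) X = begin
    sumR R (List.map Ψ (concatMap (λ b → List.map (b ∷_) (below γ)) (List.upTo (suc g))))
      ≈⟨ sumR-concatMap (List.upTo (suc g)) (λ b → List.map (b ∷_) (below γ)) Ψ ⟩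
    sumR R (List.map (λ b → sumR R (List.map Ψ (List.map (b ∷_) (below γ)))) (List.upTo (suc g)))
      ≈⟨ sumR-cong (List.upTo (suc g)) head-coordinate ⟩
    sumR R (List.map (λ b → when (does (x ℕ.≟ b)) (when (does (y ℕ.≟ g ∸ b)) Z)) (List.upTo (suc g)))
      ≈⟨ sumR-applyUpTo (suc g) (λ b → b) (λ b → when (does (x ℕ.≟ b)) (when (does (y ℕ.≟ g ∸ b)) Z)) ⟩
    sumUpTo (suc g) (λ b → when (does (x ℕ.≟ b)) (when (does (y ℕ.≟ g ∸ b)) Z))
      ≈⟨ sumUpTo-δ g x y Z ⟩
    when (does (x ℕ.+ y ℕ.≟ g)) Z
      ≈⟨ when-∧ (does (x ℕ.+ y ℕ.≟ g)) (does (Vec.zipWith ℕ._+_ xs ys ≟ᵥ γ)) X ⟨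
    when (does (Vec.zipWith ℕ._+_ (x ∷ xs) (y ∷ ys) ≟ᵥ (g ∷ γ))) X ∎
    where
    Ψ : Vec ℕ _ → Carrier
    Ψ β = when (does ((x ∷ xs) ≟ᵥ β)) (when (does ((y ∷ ys) ≟ᵥ Vec.zipWith _∸_ (g ∷ γ) β)) X)
    Z = when (does (Vec.zipWith ℕ._+_ xs ys ≟ᵥ γ)) X
    tail-coordinates : ∀ b β → Ψ (b ∷ β) ≈ when (does (x ℕ.≟ b)) (when (does (y ℕ.≟ g ∸ b))
                                 (when (does (xs ≟ᵥ β)) (when (does (ys ≟ᵥ Vec.zipWith _∸_ γ β)) X)))
    tail-coordinates b β = begin
      when (does (x ℕ.≟ b) ∧ does (xs ≟ᵥ β)) (when (does (y ℕ.≟ g ∸ b) ∧ does (ys ≟ᵥ Vec.zipWith _∸_ γ β)) X)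
        ≈⟨ trans (when-∧ (does (x ℕ.≟ b)) (does (xs ≟ᵥ β)) _)
                 (when-cong (does (x ℕ.≟ b)) (when-cong (does (xs ≟ᵥ β)) (when-∧ (does (y ℕ.≟ g ∸ b)) _ X))) ⟩
      when (does (x ℕ.≟ b)) (when (does (xs ≟ᵥ β)) (when (does (y ℕ.≟ g ∸ b)) (when (does (ys ≟ᵥ Vec.zipWith _∸_ γ β)) X)))
        ≈⟨ when-cong (does (x ℕ.≟ b)) (when-comm (does (xs ≟ᵥ β)) (does (y ℕ.≟ g ∸ b)) _) ⟩
      when (does (x ℕ.≟ b)) (when (does (y ℕ.≟ g ∸ b)) (when (does (xs ≟ᵥ β)) (when (does (ys ≟ᵥ Vec.zipWith _∸_ γ β)) X))) ∎
    head-coordinate : ∀ b → sumR R (List.map Ψ (List.map (b ∷_) (below γ)))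
                            ≈ when (does (x ℕ.≟ b)) (when (does (y ℕ.≟ g ∸ b)) Z)
    head-coordinate b = begin
      sumR R (List.map Ψ (List.map (b ∷_) (below γ)))
        ≈⟨ trans (sumR-map-∘ (below γ) (b ∷_) Ψ) (sumR-cong (below γ) (tail-coordinates b)) ⟩
      sumR R (List.map (λ β → when (does (x ℕ.≟ b)) (when (does (y ℕ.≟ g ∸ b))
                                (when (does (xs ≟ᵥ β)) (when (does (ys ≟ᵥ Vec.zipWith _∸_ γ β)) X)))) (below γ))
        ≈⟨ trans (sumR-when (below γ) _ _) (when-cong (does (x ℕ.≟ b)) (sumR-when (below γ) _ _)) ⟩
      when (does (x ℕ.≟ b)) (when (does (y ℕ.≟ g ∸ b))
        (sumR R (List.map (λ β → when (does (xs ≟ᵥ β)) (when (does (ys ≟ᵥ Vec.zipWith _∸_ γ β)) X)) (below γ))))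
        ≈⟨ when-cong (does (x ℕ.≟ b)) (when-cong (does (y ℕ.≟ g ∸ b)) (below-δ γ xs ys X)) ⟩
      when (does (x ℕ.≟ b)) (when (does (y ℕ.≟ g ∸ b)) Z) ∎

  ⊛-words : ∀ (f g : Poly R n) a b (F G : List (Fin n) → Carrier) (x y : Carrier) →
    (∀ β → x * f β ≈ sumWordsOfCount a β F) → (∀ β → y * g β ≈ sumWordsOfCount b β G) →
    ∀ γ → (x * y) * (_⊛_ R f g) γ
          ≈ sumWords n a (λ s → sumWords n b (λ t →
              when (does (Vec.zipWith ℕ._+_ (count (toList s)) (count (toList t)) ≟ᵥ γ)) (F (toList s) * G (toList t))))
  ⊛-words f g a b F G x y f-words g-words γ = begin
    (x * y) * sumR R (List.map (λ β → f β * g (γ ∸ᵥ β)) (below γ))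
      ≈⟨ *-distribˡ-sumR (below γ) (x * y) _ ⟩
    sumR R (List.map (λ β → (x * y) * (f β * g (γ ∸ᵥ β))) (below γ))
      ≈⟨ sumR-cong (below γ) (λ β → trans (*-interchange _ _ _ _) (*-cong (f-words β) (g-words _))) ⟩
    sumR R (List.map (λ β → sumWordsOfCount a β F * sumWordsOfCount b (γ ∸ᵥ β) G) (below γ))
      ≈⟨ sumR-cong (below γ) (λ β → trans (*-distribʳ-sumWords n a _ _) (sumWords-cong n a (λ s →
           trans (*-distribˡ-sumWords n b _ _) (sumWords-cong n b (λ t → when-*-when (does (count (toList s) ≟ᵥ β)) _ _ _)))))  ⟩
    sumR R (List.map (λ β → sumWords n a (λ s → sumWords n b (λ t → split β s t))) (below γ))
      ≈⟨ sumR-sumWords (below γ) n a _ ⟩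
    sumWords n a (λ s → sumR R (List.map (λ β → sumWords n b (λ t → split β s t)) (below γ)))
      ≈⟨ sumWords-cong n a (λ s → trans (sumR-sumWords (below γ) n b _)
                                        (sumWords-cong n b (λ t → below-δ γ (count (toList s)) (count (toList t)) _))) ⟩
    sumWords n a (λ s → sumWords n b (λ t →
      when (does (Vec.zipWith ℕ._+_ (count (toList s)) (count (toList t)) ≟ᵥ γ)) (F (toList s) * G (toList t)))) ∎
    where
    _∸ᵥ_ : Vec ℕ n → Vec ℕ n → Vec ℕ n
    _∸ᵥ_ = Vec.zipWith _∸_
    split : Vec ℕ n → Vec (Fin n) a → Vec (Fin n) b → Carrier
    split β s t = when (does (count (toList s) ≟ᵥ β)) (when (does (count (toList t) ≟ᵥ (γ ∸ᵥ β))) (F (toList s) * G (toList t)))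
    when-*-when : ∀ p q X Y → when p X * when q Y ≈ when p (when q (X * Y))
    when-*-when p q X Y = trans (when-*ˡ p X _) (when-cong p (when-*ʳ q X Y))

  numWords : ℕ → Vec ℕ n → Carrier
  numWords e β = sumWordsOfCount e β (λ _ → 1#)

  numWords-≢ : ∀ e β → ∣ β ∣ₘ ≢ e → numWords e β ≈ 0#
  numWords-≢ zero    β ∣β∣≢0 = reflexive (≡.cong (λ b → when b 1#) (dec-false (Vec.replicate n 0 ≟ᵥ β)
    (λ eq → ∣β∣≢0 (≡.trans (≡.cong ∣_∣ₘ (≡.sym eq)) (∣∣ₘ-replicate-0 n)))))
  numWords-≢ (suc e) β ∣β∣≢1+e = ∑-zero n first-letter
    where
    first-letter : ∀ c → sumWords n e (λ s → when (does (count (c ∷ toList s) ≟ᵥ β)) 1#) ≈ 0#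
    first-letter c with lookup β c in βc
    ... | zero  = sumWordsOfCount-∷-absent e β c (λ _ → 1#) βc
    ... | suc k = trans (sumWordsOfCount-∷ e β c (λ _ → 1#) βc)
                        (numWords-≢ e _ (λ eq → ∣β∣≢1+e (≡.trans (∣∣ₘ-updateAt-pred β c βc) (≡.cong suc eq))))

  ∑-lookup : ∀ {k} (β : Vec ℕ k) X → ∑[ c < k ] (ℕ→R R (lookup β c) * X) ≈ ℕ→R R ∣ β ∣ₘ * X
  ∑-lookup []      X = sym (zeroˡ X)
  ∑-lookup (b ∷ β) X = trans (+-congˡ (∑-lookup β X)) (trans (sym (distribʳ X _ _)) (*-congʳ (sym (ℕ→R-+ b _))))

  numWords-multinomial : ∀ e β → ∣ β ∣ₘ ≡ e → numWords e β * ℕ→R R (β !ₘ) ≈ ℕ→R R (e !)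
  numWords-multinomial zero β ∣β∣≡0 with ∣∣ₘ≡0⇒replicate-0 β ∣β∣≡0
  ... | ≡.refl = trans (*-cong (reflexive (≡.cong (λ b → when b 1#) (dec-true (β ≟ᵥ β) ≡.refl)))
                               (reflexive (≡.cong (ℕ→R R) (!ₘ-replicate-0 n))))
                       (*-identityˡ _)
  numWords-multinomial (suc e) β ∣β∣≡1+e = begin
    ∑[ c < n ] first-letter c * ℕ→R R (β !ₘ)          ≈⟨ *-distribʳ-sum _ first-letter ⟩
    ∑[ c < n ] (first-letter c * ℕ→R R (β !ₘ))        ≈⟨ sum-cong-≋ by-first-letter ⟩
    ∑[ c < n ] (ℕ→R R (lookup β c) * ℕ→R R (e !))     ≈⟨ ∑-lookup β _ ⟩
    ℕ→R R ∣ β ∣ₘ * ℕ→R R (e !)                        ≈⟨ *-congʳ (reflexive (≡.cong (ℕ→R R) ∣β∣≡1+e)) ⟩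
    ℕ→R R (suc e) * ℕ→R R (e !)                       ≈⟨ ℕ→R-* (suc e) (e !) ⟨
    ℕ→R R (suc e !)                                   ∎
    where
    first-letter : Fin n → Carrier
    first-letter c = sumWords n e (λ s → when (does (count (c ∷ toList s) ≟ᵥ β)) 1#)
    by-first-letter : ∀ c → first-letter c * ℕ→R R (β !ₘ) ≈ ℕ→R R (lookup β c) * ℕ→R R (e !)
    by-first-letter c with lookup β c in βc
    ... | zero  = trans (*-congʳ (sumWordsOfCount-∷-absent e β c (λ _ → 1#) βc)) (trans (zeroˡ _) (sym (zeroˡ _)))
    ... | suc k = begin
      first-letter c * ℕ→R R (β !ₘ)
        ≈⟨ *-cong (sumWordsOfCount-∷ e β c (λ _ → 1#) βc) (reflexive (≡.cong (ℕ→R R) (!ₘ-updateAt-pred β c βc))) ⟩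
      numWords e β′ * ℕ→R R (suc k ℕ.* β′ !ₘ)      ≈⟨ *-congˡ (ℕ→R-* (suc k) (β′ !ₘ)) ⟩
      numWords e β′ * (ℕ→R R (suc k) * ℕ→R R (β′ !ₘ)) ≈⟨ *-left-comm _ _ _ ⟩
      ℕ→R R (suc k) * (numWords e β′ * ℕ→R R (β′ !ₘ))
        ≈⟨ *-congˡ (numWords-multinomial e β′ (ℕₚ.suc-injective (≡.trans (≡.sym (∣∣ₘ-updateAt-pred β c βc)) ∣β∣≡1+e))) ⟩
      ℕ→R R (suc k) * ℕ→R R (e !) ∎
      where β′ = updateAt β c ℕ.pred

  ℕ→R-*-invℕ : ∀ m → 1 ≤ m → ℕ→R R m * invℕ R F m ≈ 1#
  ℕ→R-*-invℕ (suc m) _ = trans (*-comm _ _) (inverse (ℕ→R R (suc m)) (char0 m))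

  module _ (e : ℕ) (H : Fin n → Vec ℕ n → Carrier) where

    J : PolyMat R n
    J = jacobian R F (suc e) n H

    jacobian-words : ∀ k j β → ℕ→R R (e !) * J k j β
                               ≈ sumWordsOfCount e β (λ s → H k (count (j ∷ s)))
    jacobian-words k j β = begin
      ℕ→R R (e !) * (ℕ→R R (suc (lookup β j)) * when (does (∣ β′ ∣ₘ ℕ.≟ suc e)) (H k β′ * invℕ R F (β′ !ₘ)))
        ≈⟨ by-degree (∣ β ∣ₘ ℕ.≟ e) ⟩
      numWords e β * H k β′
        ≈⟨ *-distribʳ-sumWords n e _ _ ⟩
      sumWords n e (λ s → when (does (count (toList s) ≟ᵥ β)) 1# * H k β′)
        ≈⟨ sumWords-cong n e (λ s → trans (when-*ˡ (does (count (toList s) ≟ᵥ β)) 1# _)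
             (trans (when-cong (does (count (toList s) ≟ᵥ β)) (*-identityˡ _))
                    (sym (when-≡ _≟ᵥ_ (count (toList s)) β (λ z → H k (updateAt z j suc)))))) ⟩
      sumWordsOfCount e β (λ s → H k (count (j ∷ s))) ∎
      where
      β′ = updateAt β j suc
      by-degree : Dec (∣ β ∣ₘ ≡ e) →
        ℕ→R R (e !) * (ℕ→R R (suc (lookup β j)) * when (does (∣ β′ ∣ₘ ℕ.≟ suc e)) (H k β′ * invℕ R F (β′ !ₘ)))
        ≈ numWords e β * H k β′
      by-degree (yes ∣β∣≡e) rewrite dec-true (∣ β′ ∣ₘ ℕ.≟ suc e) (≡.trans (∣∣ₘ-updateAt-suc β j) (≡.cong suc ∣β∣≡e)) = begin
        ℕ→R R (e !) * (ℕ→R R (suc (lookup β j)) * (H k β′ * invℕ R F (β′ !ₘ)))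
          ≈⟨ *-congʳ (numWords-multinomial e β ∣β∣≡e) ⟨
        (numWords e β * ℕ→R R (β !ₘ)) * (ℕ→R R (suc (lookup β j)) * (H k β′ * invℕ R F (β′ !ₘ)))
          ≈⟨ rearrange _ _ _ _ _ ⟩
        (numWords e β * H k β′) * ((ℕ→R R (suc (lookup β j)) * ℕ→R R (β !ₘ)) * invℕ R F (β′ !ₘ))
          ≈⟨ *-congˡ (*-congʳ (trans (sym (ℕ→R-* (suc (lookup β j)) (β !ₘ)))
                                     (reflexive (≡.cong (ℕ→R R) (≡.sym (!ₘ-updateAt-suc β j)))))) ⟩
        (numWords e β * H k β′) * (ℕ→R R (β′ !ₘ) * invℕ R F (β′ !ₘ))
          ≈⟨ *-congˡ (ℕ→R-*-invℕ (β′ !ₘ) (1≤!ₘ β′)) ⟩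
        (numWords e β * H k β′) * 1#
          ≈⟨ *-identityʳ _ ⟩
        numWords e β * H k β′ ∎
        where
        open import Algebra.Solver.CommutativeMonoid *-commutativeMonoid using (solve; _⊜_) renaming (_⊕_ to _⊙_)
        rearrange : ∀ a b c h i → (a * b) * (c * (h * i)) ≈ (a * h) * ((c * b) * i)
        rearrange = solve 5 (λ a b c h i → (a ⊙ b) ⊙ (c ⊙ (h ⊙ i)) ⊜ (a ⊙ h) ⊙ ((c ⊙ b) ⊙ i)) refl
      by-degree (no ∣β∣≢e) rewrite dec-false (∣ β′ ∣ₘ ℕ.≟ suc e) (λ eq → ∣β∣≢e (ℕₚ.suc-injective (≡.trans (≡.sym (∣∣ₘ-updateAt-suc β j)) eq))) =
        trans (trans (*-congˡ (zeroʳ _)) (zeroʳ _)) (sym (trans (*-congʳ (numWords-≢ e β ∣β∣≢e)) (zeroˡ _)))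

    -- the words of length p·e read as p blocks of e letters, one block per step of a type path from i to j
    pathWeight : ℕ → Fin n → Fin n → List (Fin n) → Carrier
    pathWeight zero    i j ts = when (does (i Fin.≟ j)) 1#
    pathWeight (suc p) i j ts = ∑[ k < n ] (H i (count (k ∷ take e ts)) * pathWeight p k j (drop e ts))

    pathWeight-snoc : ∀ p i j (xs g : List (Fin n)) → length xs ≡ p ℕ.* e → length g ≡ e →
      pathWeight (suc p) i j (xs ++ g) ≈ ∑[ k < n ] (pathWeight p i k xs * H k (count (j ∷ g)))
    pathWeight-snoc zero i j [] g _ ∣g∣≡e = begin
      ∑[ k < n ] (H i (count (k ∷ take e g)) * when (does (k Fin.≟ j)) 1#)
        ≈⟨ sum-cong-≋ (λ k → trans (when-*ʳ (does (k Fin.≟ j)) _ 1#) (when-cong (does (k Fin.≟ j)) (*-identityʳ _))) ⟩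
      ∑[ k < n ] when (does (k Fin.≟ j)) (H i (count (k ∷ take e g)))
        ≈⟨ ∑-δ n j _ ⟩
      H i (count (j ∷ take e g))
        ≈⟨ reflexive (≡.cong (λ z → H i (count (j ∷ z))) (Listₚ.take-all e g (ℕₚ.≤-reflexive ∣g∣≡e))) ⟩
      H i (count (j ∷ g))
        ≈⟨ ∑-δ′ n i _ ⟨
      ∑[ k < n ] when (does (i Fin.≟ k)) (H k (count (j ∷ g)))
        ≈⟨ sum-cong-≋ (λ k → trans (when-*ˡ (does (i Fin.≟ k)) 1# _) (when-cong (does (i Fin.≟ k)) (*-identityˡ _))) ⟨
      ∑[ k < n ] (when (does (i Fin.≟ k)) 1# * H k (count (j ∷ g))) ∎
    pathWeight-snoc (suc p) i j xs g ∣xs∣≡ ∣g∣≡e = begin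
      ∑[ k < n ] (H i (count (k ∷ take e (xs ++ g))) * pathWeight (suc p) k j (drop e (xs ++ g)))
        ≈⟨ sum-cong-≋ (λ k → reflexive (≡.cong₂ (λ u v → H i (count (k ∷ u)) * pathWeight (suc p) k j v)
                                                (take-++ e xs g e≤∣xs∣) (drop-++ e xs g e≤∣xs∣))) ⟩
      ∑[ k < n ] (H i (count (k ∷ take e xs)) * pathWeight (suc p) k j (drop e xs ++ g))
        ≈⟨ sum-cong-≋ (λ k → *-congˡ (pathWeight-snoc p k j (drop e xs) g ∣drop∣≡ ∣g∣≡e)) ⟩
      ∑[ k < n ] (H i (count (k ∷ take e xs)) * ∑[ l < n ] (pathWeight p k l (drop e xs) * H l (count (j ∷ g))))
        ≈⟨ sum-cong-≋ (λ k → *-distribˡ-sum (Hᵢ k) (λ l → P k l * Hⱼ l)) ⟩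
      ∑[ k < n ] ∑[ l < n ] (Hᵢ k * (P k l * Hⱼ l))
        ≈⟨ ∑-comm (λ k l → Hᵢ k * (P k l * Hⱼ l)) ⟩
      ∑[ l < n ] ∑[ k < n ] (Hᵢ k * (P k l * Hⱼ l))
        ≈⟨ sum-cong-≋ (λ l → trans (sum-cong-≋ (λ k → sym (*-assoc (Hᵢ k) (P k l) (Hⱼ l)))) (sym (*-distribʳ-sum (Hⱼ l) (λ k → Hᵢ k * P k l)))) ⟩
      ∑[ l < n ] (pathWeight (suc p) i l xs * H l (count (j ∷ g))) ∎
      where
      Hᵢ Hⱼ : Fin n → Carrier
      Hᵢ k = H i (count (k ∷ take e xs))
      Hⱼ l = H l (count (j ∷ g))
      P : Fin n → Fin n → Carrier
      P k l = pathWeight p k l (drop e xs)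
      e≤∣xs∣ : e ≤ length xs
      e≤∣xs∣ = ≡.subst (e ≤_) (≡.sym ∣xs∣≡) (ℕₚ.m≤m+n e (p ℕ.* e))
      ∣drop∣≡ : length (drop e xs) ≡ p ℕ.* e
      ∣drop∣≡ = ≡.trans (Listₚ.length-drop e xs) (≡.trans (≡.cong (_∸ e) ∣xs∣≡) (ℕₚ.m+n∸m≡n e (p ℕ.* e)))
      take-++ : ∀ {A : Set} k (ys zs : List A) → k ≤ length ys → take k (ys ++ zs) ≡ take k ys
      take-++ zero    ys       zs _         = ≡.refl
      take-++ (suc k) (y ∷ ys) zs (s≤s k≤) = ≡.cong (y ∷_) (take-++ k ys zs k≤)
      drop-++ : ∀ {A : Set} k (ys zs : List A) → k ≤ length ys → drop k (ys ++ zs) ≡ drop k ys ++ zs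
      drop-++ zero    ys       zs _         = ≡.refl
      drop-++ (suc k) (y ∷ ys) zs (s≤s k≤) = drop-++ k ys zs k≤

    matMul-apply : ∀ (A B : PolyMat R n) i j γ →
                   matMul R A B i j γ ≡ sumR R (List.map (λ k → (_⊛_ R (A i k) (B k j)) γ) (allFin n))
    matMul-apply A B i j γ = foldr-apply (allFin n)
      where
      foldr-apply : ∀ ks → List.foldr (λ k acc → _⊕_ R (_⊛_ R (A i k) (B k j)) acc) (0ₚ R) ks γ
                           ≡ sumR R (List.map (λ k → (_⊛_ R (A i k) (B k j)) γ) ks)
      foldr-apply []       = ≡.refl
      foldr-apply (k ∷ ks) = ≡.cong (_⊛_ R (A i k) (B k j) γ +_) (foldr-apply ks)

    matPow-words : ∀ p i j γ → ℕ→R R (e !) ^ p * matPow R J p i j γ ≈ sumWordsOfCount (p ℕ.* e) γ (pathWeight p i j)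
    matPow-words zero i j γ with i Fin.≟ j
    ... | yes ≡.refl = trans (*-identityˡ _) (reflexive (≡.cong (λ b → when b 1#) (isZeroᵥ≡does-replicate-0 γ)))
    ... | no  _      = trans (zeroʳ _) (sym (when-zero _))
    matPow-words (suc p) i j γ = begin
      (E * E ^ p) * matMul R (matPow R J p) J i j γ
        ≈⟨ *-cong (*-comm E (E ^ p)) (trans (reflexive (matMul-apply (matPow R J p) J i j γ)) (sumR-allFin n _)) ⟩
      (E ^ p * E) * ∑[ k < n ] (_⊛_ R (matPow R J p i k) (J k j) γ)
        ≈⟨ *-distribˡ-sum (E ^ p * E) (λ k → _⊛_ R (matPow R J p i k) (J k j) γ) ⟩
      ∑[ k < n ] ((E ^ p * E) * _⊛_ R (matPow R J p i k) (J k j) γ)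
        ≈⟨ sum-cong-≋ (λ k → ⊛-words (matPow R J p i k) (J k j) (p ℕ.* e) e (pathWeight p i k) (λ s → H k (count (j ∷ s)))
                                      (E ^ p) E (matPow-words p i k) (jacobian-words k j) γ) ⟩
      ∑[ k < n ] sumWords n (p ℕ.* e) (λ s → sumWords n e (λ t → when (split s t) (Step k s t)))
        ≈⟨ sumWords-∑ n (p ℕ.* e) n (λ s k → sumWords n e (λ t → when (split s t) (Step k s t))) ⟨
      sumWords n (p ℕ.* e) (λ s → ∑[ k < n ] sumWords n e (λ t → when (split s t) (Step k s t)))
        ≈⟨ sumWords-cong n (p ℕ.* e) (λ s → trans (sym (sumWords-∑ n e n (λ t k → when (split s t) (Step k s t))))
             (sumWords-cong n e (λ t → trans (sym (∑-when n (split s t) (λ k → Step k s t)))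
               (when-cong (split s t) (sym (pathWeight-snoc p i j (toList s) (toList t)
                                                            (Vecₚ.length-toList s) (Vecₚ.length-toList t))))))) ⟩
      sumWords n (p ℕ.* e) (λ s → sumWords n e (λ t → when (split s t) (pathWeight (suc p) i j (toList s ++ toList t))))
        ≈⟨ sumWords-cong n (p ℕ.* e) (λ s → sumWords-cong n e (λ t → reflexive
             (≡.cong₂ (λ u v → when (does (u ≟ᵥ γ)) (pathWeight (suc p) i j v))
                      (≡.sym (≡.trans (≡.cong count (Vecₚ.toList-++ s t)) (count-++ (toList s) (toList t))))
                      (≡.sym (Vecₚ.toList-++ s t))))) ⟩
      sumWords n (p ℕ.* e) (λ s → sumWords n e (λ t →
        when (does (count (toList (s Vec.++ t)) ≟ᵥ γ)) (pathWeight (suc p) i j (toList (s Vec.++ t)))))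
        ≈⟨ sumWords-++ n (p ℕ.* e) e _ ⟨
      sumWordsOfCount (p ℕ.* e ℕ.+ e) γ (pathWeight (suc p) i j)
        ≈⟨ sumWords-cast n (ℕₚ.+-comm (p ℕ.* e) e) (λ w → when (does (count w ≟ᵥ γ)) (pathWeight (suc p) i j w)) ⟩
      sumWordsOfCount (suc p ℕ.* e) γ (pathWeight (suc p) i j) ∎
      where
      E = ℕ→R R (e !)
      split : Vec (Fin n) (p ℕ.* e) → Vec (Fin n) e → Bool
      split s t = does (Vec.zipWith ℕ._+_ (count (toList s)) (count (toList t)) ≟ᵥ γ)
      Step : Fin n → Vec (Fin n) (p ℕ.* e) → Vec (Fin n) e → Carrier
      Step k s t = pathWeight p i k (toList s) * H k (count (j ∷ toList t))

    -- pathWeight with the intermediate types ρs fixed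
    spineWeight : Fin n → List (Fin n) → Fin n → List (Fin n) → Carrier
    spineWeight r []       τ ts = H r (count (τ ∷ take e ts))
    spineWeight r (ρ ∷ ρs) τ ts = H r (count (ρ ∷ take e ts)) * spineWeight ρ ρs τ (drop e ts)

    sumWords-spineWeight : ∀ q r τ ts → sumWords n q (λ ρs → spineWeight r (toList ρs) τ ts) ≈ pathWeight (suc q) r τ ts
    sumWords-spineWeight zero r τ ts = sym (begin
      ∑[ k < n ] (H r (count (k ∷ take e ts)) * when (does (k Fin.≟ τ)) 1#)
        ≈⟨ sum-cong-≋ (λ k → trans (when-*ʳ (does (k Fin.≟ τ)) _ 1#) (when-cong (does (k Fin.≟ τ)) (*-identityʳ _))) ⟩
      ∑[ k < n ] when (does (k Fin.≟ τ)) (H r (count (k ∷ take e ts)))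
        ≈⟨ ∑-δ n τ _ ⟩
      H r (count (τ ∷ take e ts)) ∎)
    sumWords-spineWeight (suc q) r τ ts = sum-cong-≋ (λ k →
      trans (sym (*-distribˡ-sumWords n q _ _)) (*-congˡ (sumWords-spineWeight q k τ (drop e ts))))

-- Weights of shuffled trees

module Weights {ℓ₁ ℓ₂ : Level} (R : CommutativeRing ℓ₁ ℓ₂) (F : IsCharZeroField R) (e n : ℕ)
               (H : Fin n → Vec ℕ n → CommutativeRing.Carrier R) where

  open CommutativeRing R
  open Sums R
  open Trees e n
  open JacobianWords R F n
  open import Algebra.Definitions.RawSemiring (Semiring.rawSemiring semiring) using (_^_)
  open import Relation.Binary.Reasoning.Setoid setoid

  w : T → Carrier
  w = weightH R H

  weight-node : ∀ x (f : Fin d → T) → w (node x f) ≈ H x (count (tabulate (rootType ∘ f))) * product (w ∘ f)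
  weight-node x f = *-cong (reflexive (≡.cong (H x) (childTypeCount≡count f))) (reflexive (prodR-allFin d (w ∘ f)))

  weight-≋ : ∀ {t u} → t ≋ u → w t ≈ w u
  weight-≋ leaf≋ = refl
  weight-≋ {node a f} {node .a g} (node≋ f≋g) = begin
    w (node a f)                                               ≈⟨ weight-node a f ⟩
    H a (count (tabulate (rootType ∘ f))) * product (w ∘ f)    ≈⟨ *-cong (reflexive (≡.cong (λ z → H a (count z))
                                                                      (Listₚ.tabulate-cong (rootType-≋ ∘ f≋g))))
                                                                    (product-cong (weight-≋ ∘ f≋g)) ⟩
    H a (count (tabulate (rootType ∘ g))) * product (w ∘ g)    ≈⟨ weight-node a g ⟨
    w (node a g)                                               ∎

  weight-modifyAt : ∀ t a {u} → subtreeAt t a ≡ just u →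
    Σ Carrier (λ K → ∀ φ → rootType (φ u) ≡ rootType u → w (modifyAt t a φ) ≈ K * w (φ u))
  weight-modifyAt t          []      ≡.refl = 1# , (λ φ _ → sym (*-identityˡ _))
  weight-modifyAt (node x f) (c ∷ a) {u} eq with weight-modifyAt (f c) a eq
  ... | K , factor = H x (count (tabulate (rootType ∘ f))) * (K * product (w ∘ f ∘ punchIn c)) , factor′
    where
    factor′ : ∀ φ → rootType (φ u) ≡ rootType u →
              w (modifyAt (node x f) (c ∷ a) φ) ≈ (H x (count (tabulate (rootType ∘ f))) * (K * product (w ∘ f ∘ punchIn c))) * w (φ u)
    factor′ φ rt = begin
      w (node x g)
        ≈⟨ weight-node x g ⟩
      H x (count (tabulate (rootType ∘ g))) * product (w ∘ g)
        ≈⟨ *-cong (reflexive (≡.cong (λ z → H x (count z)) (Listₚ.tabulate-cong rootType-g))) (product-remove {i = c} (w ∘ g)) ⟩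
      H x (count (tabulate (rootType ∘ f))) * (w (g c) * product (w ∘ g ∘ punchIn c))
        ≈⟨ *-congˡ (*-cong (reflexive (≡.cong (λ b → w (if b then modifyAt (f c) a φ else f c)) (dec-true (c Fin.≟ c) ≡.refl)))
                           (product-cong (λ j → reflexive (≡.cong (λ b → w (if b then modifyAt (f (punchIn c j)) a φ else f (punchIn c j)))
                                                                  (dec-false (punchIn c j Fin.≟ c) (punchInᵢ≢i c j)))))) ⟩
      H x (count (tabulate (rootType ∘ f))) * (w (modifyAt (f c) a φ) * product (w ∘ f ∘ punchIn c))
        ≈⟨ *-congˡ (*-congʳ (factor φ rt)) ⟩
      H x (count (tabulate (rootType ∘ f))) * ((K * w (φ u)) * product (w ∘ f ∘ punchIn c))
        ≈⟨ *-congˡ (trans (*-assoc _ _ _) (trans (*-congˡ (*-comm _ _)) (sym (*-assoc _ _ _)))) ⟩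
      H x (count (tabulate (rootType ∘ f))) * ((K * product (w ∘ f ∘ punchIn c)) * w (φ u))
        ≈⟨ *-assoc _ _ _ ⟨
      (H x (count (tabulate (rootType ∘ f))) * (K * product (w ∘ f ∘ punchIn c))) * w (φ u) ∎
      where
      g = modifyChild c (λ u → modifyAt u a φ) f
      rootType-g : ∀ j → rootType (g j) ≡ rootType (f j)
      rootType-g j with j Fin.≟ c
      ... | yes ≡.refl = rootType-modifyAt (f j) a φ eq rt
      ... | no  _      = ≡.refl

  -- A missing source never occurs on a valid path; `fallback` and 1# are junk values for it.
  module _ (fallback : Fin n) where

    typeOf : Maybe T → Fin n
    typeOf (just t) = rootType t
    typeOf nothing  = fallback

    weightOf : Maybe T → Carrier
    weightOf (just t) = w t
    weightOf nothing  = 1#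

    weight-spine-node : ∀ c cs f r srcs ρs (len : length (take e srcs) ≡ e) → All Is-just (take e srcs) →
      let open SpineStep c cs f srcs ρs len in
      w (node r children) ≈ H r (count (rootType spineChild ∷ List.map typeOf near))
                              * (w spineChild * prodR R (List.map weightOf near))
    weight-spine-node c cs f r srcs ρs len js = begin
      w (node r children)
        ≈⟨ weight-node r children ⟩
      H r (count (tabulate (rootType ∘ children))) * product (w ∘ children)
        ≈⟨ *-cong (reflexive (≡.cong (H r) (count-tabulate-punchIn e (rootType ∘ children) c)))
                  (product-remove {i = c} (w ∘ children)) ⟩
      H r (count (rootType (children c) ∷ tabulate (rootType ∘ children ∘ punchIn c)))
        * (w (children c) * product (w ∘ children ∘ punchIn c))
        ≈⟨ *-cong (reflexive (≡.cong₂ (λ a b → H r (count (rootType a ∷ b))) children-spine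
                                      (children-off-spine-read rootType typeOf (λ _ → ≡.refl) js)))
                  (*-cong (reflexive (≡.cong w children-spine))
                          (reflexive (≡.trans (≡.sym (prodR-tabulate e (w ∘ children ∘ punchIn c)))
                                              (≡.cong (prodR R) (children-off-spine-read w weightOf (λ _ → ≡.refl) js))))) ⟩
      H r (count (rootType spineChild ∷ List.map typeOf near)) * (w spineChild * prodR R (List.map weightOf near)) ∎
      where open SpineStep c cs f srcs ρs len

    shuffledSpine : ∀ cs c (f : Fin d → T) r srcs ρs → T
    shuffledSpine cs c f r srcs ρs =
      retypeAll (node r (λ j → graftAll (f j) (inChild j (zip (siblings [] (c ∷ cs)) srcs)))) (zip (inners [] (c ∷ cs)) ρs)

    weight-shuffledSpine : ∀ cs c f r srcs ρs (len : length (take e srcs) ≡ e) → All Is-just srcs →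
      let open SpineStep c cs f srcs ρs len in
      w (shuffledSpine cs c f r srcs ρs)
      ≈ H r (count (rootType spineChild ∷ List.map typeOf near)) * (w spineChild * prodR R (List.map weightOf near))
    weight-shuffledSpine cs c f r srcs ρs len js =
      trans (weight-≋ (retypeAll-node r _ (zip (inners [] (c ∷ cs)) ρs) (NonRoot-inners (c ∷ cs) ρs)))
            (weight-spine-node c cs f r srcs ρs len (Allₚ.take⁺ e js))

    weight-spine : ∀ cs c x f r srcs ρs {vₚ} → subtreeAt (node x f) (c ∷ cs) ≡ just vₚ → All Is-just srcs →
      length srcs ≡ suc (length cs) ℕ.* e → length ρs ≡ length cs →
      w (shuffledSpine cs c f r srcs ρs)
      ≈ spineWeight e H r ρs (rootType vₚ) (List.map typeOf srcs) * (prodR R (List.map weightOf srcs) * w vₚ)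
    weight-spine [] c x f r srcs [] ≡.refl js ∣srcs∣ _ = begin
      w (shuffledSpine [] c f r srcs [])
        ≈⟨ weight-shuffledSpine [] c f r srcs [] ∣near∣ js ⟩
      H r (count (rootType (f c) ∷ List.map typeOf (take e srcs))) * (w (f c) * prodR R (List.map weightOf (take e srcs)))
        ≈⟨ *-cong (reflexive (≡.cong (λ z → H r (count (rootType (f c) ∷ z))) (≡.sym (Listₚ.take-map e srcs))))
                  (trans (*-comm _ _) (*-congʳ (reflexive (≡.cong (prodR R ∘ List.map weightOf) near≡srcs)))) ⟩
      H r (count (rootType (f c) ∷ take e (List.map typeOf srcs))) * (prodR R (List.map weightOf srcs) * w (f c)) ∎
      where
      ∣near∣ = length-take-+ e srcs ∣srcs∣
      near≡srcs : take e srcs ≡ srcs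
      near≡srcs = Listₚ.take-all e srcs (ℕₚ.≤-reflexive (≡.trans ∣srcs∣ (ℕₚ.+-identityʳ e)))
    weight-spine (c′ ∷ cs) c x f r srcs (ρ ∷ ρs) {vₚ} sub js ∣srcs∣ ∣ρs∣ with f c in fc≡
    ... | node x′ f′ = begin
      w (shuffledSpine (c′ ∷ cs) c f r srcs (ρ ∷ ρs))
        ≈⟨ weight-shuffledSpine (c′ ∷ cs) c f r srcs (ρ ∷ ρs) ∣near∣ js ⟩
      H r (count (rootType spineChild ∷ List.map typeOf near)) * (w spineChild * Pnear)
        ≈⟨ *-cong (reflexive (≡.cong (λ z → H r (count (z ∷ List.map typeOf near))) rootType-spineChild))
                  (*-congʳ (trans (weight-≋ spineChild≋)
                                  (weight-spine cs c′ x′ f′ ρ far ρs sub (Allₚ.drop⁺ e js) ∣far∣ (ℕₚ.suc-injective ∣ρs∣)))) ⟩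
      H r (count (ρ ∷ List.map typeOf near)) * ((spineWeight e H ρ ρs (rootType vₚ) (List.map typeOf far) * (Pfar * w vₚ)) * Pnear)
        ≈⟨ rearrange _ _ _ _ _ ⟩
      (H r (count (ρ ∷ List.map typeOf near)) * spineWeight e H ρ ρs (rootType vₚ) (List.map typeOf far)) * ((Pnear * Pfar) * w vₚ)
        ≈⟨ *-cong (reflexive (≡.cong₂ (λ u v → H r (count (ρ ∷ u)) * spineWeight e H ρ ρs (rootType vₚ) v)
                                      (≡.sym (Listₚ.take-map e srcs)) (≡.sym (Listₚ.drop-map e srcs))))
                  (*-congʳ (sym sources-product)) ⟩
      spineWeight e H r (ρ ∷ ρs) (rootType vₚ) (List.map typeOf srcs) * (prodR R (List.map weightOf srcs) * w vₚ) ∎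
      where
      ∣near∣ = length-take-+ e srcs ∣srcs∣
      ∣far∣ = length-drop-+ e srcs ∣srcs∣
      open SpineStep c (c′ ∷ cs) f srcs (ρ ∷ ρs) ∣near∣
      Pnear Pfar : Carrier
      Pnear = prodR R (List.map weightOf near)
      Pfar = prodR R (List.map weightOf far)
      G′ : Fin d → T
      G′ j = graftAll (f′ j) (inChild j (zip (siblings [] (c′ ∷ cs)) far))
      spineChild≋ : spineChild ≋ retypeAll (node ρ G′) (zip (inners [] (c′ ∷ cs)) ρs)
      spineChild≋ = retypeAll-≋ (zip (inners [] (c′ ∷ cs)) ρs) (retype-≋ [] ρ
        (≋-trans (≋-reflexive (≡.cong (λ z → graftAll z (zip (siblings [] (c′ ∷ cs)) far)) fc≡))
                 (graftAll-node x′ f′ _ (NonRoot-siblings (c′ ∷ cs) far))))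
      rootType-spineChild : rootType spineChild ≡ ρ
      rootType-spineChild = ≡.trans (rootType-≋ spineChild≋)
        (rootType-≋ (retypeAll-node ρ G′ (zip (inners [] (c′ ∷ cs)) ρs) (NonRoot-inners (c′ ∷ cs) ρs)))
      sources-product : prodR R (List.map weightOf srcs) ≈ Pnear * Pfar
      sources-product = trans (reflexive (≡.trans (≡.cong (prodR R ∘ List.map weightOf) (≡.sym (Listₚ.take++drop≡id e srcs)))
                                                  (≡.cong (prodR R) (Listₚ.map-++ weightOf near far))))
                              (prodR-++ (List.map weightOf near) (List.map weightOf far))
      rearrange : ∀ a b p q v → a * ((b * (q * v)) * p) ≈ (a * b) * ((p * q) * v)
      rearrange = solve 5 (λ a b p q v → a ⊙ ((b ⊙ (q ⊙ v)) ⊙ p) ⊜ (a ⊙ b) ⊙ ((p ⊙ q) ⊙ v)) refl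
        where open import Algebra.Solver.CommutativeMonoid *-commutativeMonoid using (solve; _⊜_) renaming (_⊕_ to _⊙_)

    module ShuffleClass (q : ℕ) (t : T) (a : Address d) (c : Fin d) (cs : Vec (Fin d) q)
                        {x f vₚ} (at-v₀ : subtreeAt t a ≡ just (node x f))
                        (at-vₚ : subtreeAt (node x f) (c ∷ toList cs) ≡ just vₚ) where

      path : Vec (Fin d) (suc q)
      path = c ∷ cs

      sibs : List (Address d)
      sibs = siblings a (toList path)

      m : ℕ
      m = length sibs

      source : Fin m → Maybe T
      source k = subtreeAt t (lookup (Vec.fromList sibs) k)

      sources : Vec (Fin m) m → List (Maybe T)
      sources σ = toList (Vec.map source σ)

      m≡ : m ≡ suc q ℕ.* e
      m≡ = ≡.trans (≡.cong length (siblings-prefix a (toList path)))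
             (≡.trans (Listₚ.length-map _ (siblings [] (toList path)))
               (≡.trans (length-siblings (toList path)) (≡.cong (ℕ._* e) (Vecₚ.length-toList path))))

      sources-exist : ∀ k → Is-just (source k)
      sources-exist k = lookup-fromList sibs (≡.subst (All (Is-just ∘ subtreeAt t)) (≡.sym (siblings-prefix a (toList path)))
        (Allₚ.map⁺ (All.map (λ {b} v → ≡.subst Is-just (≡.sym (subtreeAt-++ t a b at-v₀)) v)
                            (siblings-exist (node x f) (toList path) (≡.subst Is-just (≡.sym at-vₚ) (MaybeAny.just tt)))))) k
        where
        lookup-fromList : ∀ {P : Address d → Set} xs → All P xs → ∀ k → P (lookup (Vec.fromList xs) k)
        lookup-fromList (_ ∷ _)  (p ∷ _)  Fin.zero    = p
        lookup-fromList (_ ∷ xs) (_ ∷ ps) (Fin.suc k) = lookup-fromList xs ps k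

      K : Carrier
      K = proj₁ (weight-modifyAt t a at-v₀)

      weight-member : ∀ σ ρs → length ρs ≡ q →
        w (retypeAll (permuteSubtrees t (Vec.fromList sibs) σ) (zip (inners a (toList path)) ρs))
        ≈ K * (spineWeight e H x ρs (rootType vₚ) (List.map typeOf (sources σ)) * (prodR R (List.map weightOf (sources σ)) * w vₚ))
      weight-member σ ρs ∣ρs∣ = begin
        w (retypeAll (permuteSubtrees t (Vec.fromList sibs) σ) (zip (inners a (toList path)) ρs))
          ≈⟨ reflexive (≡.cong₂ (λ A B → w (retypeAll A B))
               (≡.trans (permuteSubtrees≡graftAll t (Vec.fromList sibs) σ)
                        (≡.cong (graftAll t) (≡.trans (≡.cong (λ z → zip z (sources σ))
                                                               (≡.trans (Vecₚ.toList∘fromList sibs) (siblings-prefix a (toList path))))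
                                                      (zip-prefix a (siblings [] (toList path)) (sources σ)))))
               (≡.trans (≡.cong (λ z → zip z ρs) (inners-prefix a (toList path))) (zip-prefix a (inners [] (toList path)) ρs))) ⟩
        w (retypeAll (graftAll t (prefixAll a Ls)) (prefixAll a Lr))
          ≈⟨ weight-≋ (≋-trans (retypeAll-≋ (prefixAll a Lr) (graftAll-prefixAll t a Ls))
                               (retypeAll-prefixAll t a (λ u → graftAll u Ls) Lr)) ⟩
        w (modifyAt t a shuffle)
          ≈⟨ proj₂ (weight-modifyAt t a at-v₀) shuffle (rootType-≋ (≋-trans shuffle≋ (retypeAll-node x G Lr (NonRoot-inners (toList path) ρs)))) ⟩
        K * w (shuffle (node x f))
          ≈⟨ *-congˡ (weight-≋ shuffle≋) ⟩
        K * w (shuffledSpine (toList cs) c f x (sources σ) ρs)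
          ≈⟨ *-congˡ (weight-spine (toList cs) c x f x (sources σ) ρs at-vₚ
                       (all-sources σ) ∣sources∣ (≡.trans ∣ρs∣ (≡.sym (Vecₚ.length-toList cs)))) ⟩
        K * (spineWeight e H x ρs (rootType vₚ) (List.map typeOf (sources σ)) * (prodR R (List.map weightOf (sources σ)) * w vₚ)) ∎
        where
        Ls = zip (siblings [] (toList path)) (sources σ)
        Lr = zip (inners [] (toList path)) ρs
        shuffle : T → T
        shuffle u = retypeAll (graftAll u Ls) Lr
        G : Fin d → T
        G j = graftAll (f j) (inChild j Ls)
        shuffle≋ : shuffle (node x f) ≋ retypeAll (node x G) Lr
        shuffle≋ = retypeAll-≋ Lr (graftAll-node x f Ls (NonRoot-siblings (toList path) (sources σ)))
        all-sources : ∀ {k} (τ : Vec (Fin m) k) → All Is-just (toList (Vec.map source τ))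
        all-sources []      = []
        all-sources (k ∷ τ) = sources-exist k ∷ all-sources τ
        ∣sources∣ : length (sources σ) ≡ suc (length (toList cs)) ℕ.* e
        ∣sources∣ = ≡.trans (Vecₚ.length-toList (Vec.map source σ))
                            (≡.trans m≡ (≡.cong (λ z → suc z ℕ.* e) (≡.sym (Vecₚ.length-toList cs))))

      member : Vec (Fin m) m → Vec (Fin n) q → T
      member σ ρs = retypeAll (permuteSubtrees t (Vec.fromList sibs) σ) (zip (inners a (toList path)) (toList ρs))

      types : Vec (Fin m) m → List (Fin n)
      types σ = List.map typeOf (sources σ)

      weights : Vec (Fin m) m → Carrier
      weights σ = prodR R (List.map weightOf (sources σ))

      sumWords-member : ∀ σ → sumWords n q (w ∘ member σ)
                              ≈ (K * w vₚ) * (pathWeight e H (suc q) x (rootType vₚ) (types σ) * weights σ)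
      sumWords-member σ = begin
        sumWords n q (w ∘ member σ)
          ≈⟨ sumWords-cong n q (λ ρs → trans (weight-member σ (toList ρs) (Vecₚ.length-toList ρs))
                                             (rearrange K _ (weights σ) (w vₚ))) ⟩
        sumWords n q (λ ρs → (K * w vₚ) * (spineWeight e H x (toList ρs) (rootType vₚ) (types σ) * weights σ))
          ≈⟨ *-distribˡ-sumWords n q (K * w vₚ) _ ⟨
        (K * w vₚ) * sumWords n q (λ ρs → spineWeight e H x (toList ρs) (rootType vₚ) (types σ) * weights σ)
          ≈⟨ *-congˡ (trans (sym (*-distribʳ-sumWords n q (weights σ) _))
                            (*-congʳ (sumWords-spineWeight e H q x (rootType vₚ) (types σ)))) ⟩
        (K * w vₚ) * (pathWeight e H (suc q) x (rootType vₚ) (types σ) * weights σ) ∎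
        where
        rearrange : ∀ k s p v → k * (s * (p * v)) ≈ (k * v) * (s * p)
        rearrange = solve 4 (λ k s p v → k ⊙ (s ⊙ (p ⊙ v)) ⊜ (k ⊙ v) ⊙ (s ⊙ p)) refl
          where open import Algebra.Solver.CommutativeMonoid *-commutativeMonoid using (solve; _⊜_) renaming (_⊕_ to _⊙_)

      γ : Vec ℕ n
      γ = count (tabulate (typeOf ∘ source))

      shuffleClass-sum : sumR R (List.map w (shuffleClass t a path))
        ≈ (K * w vₚ) * ((ℕ→R R (γ !ₘ) * product (weightOf ∘ source))
                        * (ℕ→R R (e !) ^ suc q * matPow R (J e H) (suc q) x (rootType vₚ) γ))
      shuffleClass-sum = begin
        sumR R (List.map w (shuffleClass t a path))
          ≈⟨ sumR-concatMap (perms m) (λ σ → List.map (member σ) (allVecs n q)) w ⟩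
        sumR R (List.map (λ σ → sumR R (List.map w (List.map (member σ) (allVecs n q)))) (perms m))
          ≈⟨ sumR-cong (perms m) (λ σ → trans (sumR-map-∘ (allVecs n q) (member σ) w) (sumR-allVecs n q _)) ⟩
        sumR R (List.map (λ σ → sumWords n q (w ∘ member σ)) (perms m))
          ≈⟨ sumR-perms m _ ⟩
        sumPerms m (λ σ → sumWords n q (w ∘ member σ))
          ≈⟨ sumPerms-cong m sumWords-member ⟩
        sumPerms m (λ σ → (K * w vₚ) * (pathWeight e H (suc q) x τ (types σ) * weights σ))
          ≈⟨ *-distribˡ-sumPerms m (K * w vₚ) _ ⟨
        (K * w vₚ) * sumPerms m (λ σ → pathWeight e H (suc q) x τ (types σ) * weights σ)
          ≈⟨ *-congˡ (sumPerms-cong m (λ σ → reflexive (≡.cong₂ (λ A B → pathWeight e H (suc q) x τ A * prodR R B)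
                                                                (map-sources typeOf σ) (map-sources weightOf σ)))) ⟩
        (K * w vₚ) * arrangements m (typeOf ∘ source) (weightOf ∘ source) (pathWeight e H (suc q) x τ)
          ≈⟨ *-congˡ (arrangements-count m (typeOf ∘ source) (weightOf ∘ source) (pathWeight e H (suc q) x τ)) ⟩
        (K * w vₚ) * ((ℕ→R R (γ !ₘ) * product (weightOf ∘ source)) * sumWordsOfCount m γ (pathWeight e H (suc q) x τ))
          ≈⟨ *-congˡ (*-congˡ (trans (sumWords-cast n m≡ (λ l → when (does (count l ≟ᵥ γ)) (pathWeight e H (suc q) x τ l)))
                                     (sym (matPow-words e H (suc q) x τ γ)))) ⟩
        (K * w vₚ) * ((ℕ→R R (γ !ₘ) * product (weightOf ∘ source)) * (ℕ→R R (e !) ^ suc q * matPow R (J e H) (suc q) x τ γ)) ∎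
        where
        τ = rootType vₚ
        map-sources : ∀ {ℓ} {A : Set ℓ} (g : Maybe T → A) σ → List.map g (sources σ) ≡ toList (Vec.map (g ∘ source) σ)
        map-sources g σ = ≡.trans (≡.sym (Vecₚ.toList-map g (Vec.map source σ))) (≡.cong toList (≡.sym (Vecₚ.map-∘ g source σ)))

    path-vertices : ∀ t a (c : Fin d) cs → Is-just (subtreeAt t (a ++ c ∷ cs)) →
      Σ (Fin n × (Fin d → T) × T) (λ (x , f , vₚ) → subtreeAt t a ≡ just (node x f) × subtreeAt (node x f) (c ∷ cs) ≡ just vₚ)
    path-vertices t a c cs valid with subtreeAt-prefix t a (c ∷ cs) valid
    ... | leaf y , at-v₀ with ≡.subst Is-just (subtreeAt-++ t a (c ∷ cs) at-v₀) valid
    ...   | ()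
    path-vertices t a c cs valid | node x f , at-v₀
      with subtreeAt (node x f) (c ∷ cs) in at-vₚ | ≡.subst Is-just (subtreeAt-++ t a (c ∷ cs) at-v₀) valid
    ... | just vₚ | _ = (x , f , vₚ) , at-v₀ , at-vₚ

    shuffleClass-sum-zero : ∀ q → JacNilp R F (suc e) n H (suc q) → ∀ t a (cs : Vec (Fin d) (suc q)) → ValidPath t a cs →
                            sumR R (List.map w (shuffleClass t a cs)) ≈ 0#
    shuffleClass-sum-zero q nilpotent t a (c ∷ cs) valid with path-vertices t a c (toList cs) valid
    ... | (x , f , vₚ) , at-v₀ , at-vₚ = begin
      sumR R (List.map w (shuffleClass t a (c ∷ cs)))
        ≈⟨ shuffleClass-sum ⟩
      (K * w vₚ) * ((ℕ→R R (γ !ₘ) * product (weightOf ∘ source)) * (ℕ→R R (e !) ^ suc q * matPow R (J e H) (suc q) x (rootType vₚ) γ))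
        ≈⟨ *-congˡ (*-congˡ (*-congˡ (nilpotent x (rootType vₚ) γ))) ⟩
      (K * w vₚ) * ((ℕ→R R (γ !ₘ) * product (weightOf ∘ source)) * (ℕ→R R (e !) ^ suc q * 0#))
        ≈⟨ *-congˡ (trans (*-congˡ (zeroʳ _)) (zeroʳ _)) ⟩
      (K * w vₚ) * 0#
        ≈⟨ zeroʳ _ ⟩
      0# ∎
      where open ShuffleClass q t a c cs at-v₀ at-vₚ

lemma3p6 : ∀ {c ℓ : Level} (R : CommutativeRing c ℓ) (F : IsCharZeroField R)
    (d n : ℕ) → 2 ≤ d → 1 ≤ n →
    (H : Fin n → Vec ℕ n → CommutativeRing.Carrier R) →
    (p : ℕ) → 1 ≤ p → p ≤ n →
    JacNilp R F d n H p →
    (T : Tree d n) (a : Address d) (cs : Vec (Fin d) p) →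
    ValidPath T a cs →
    CommutativeRing._≈_ R (sumR R (map (weightH R H) (shuffleClass T a cs))) (CommutativeRing.0# R)
lemma3p6 R F (suc (suc e)) (suc n) (s≤s (s≤s z≤n)) (s≤s z≤n) H (suc q) (s≤s z≤n) _ nilpotent T a cs valid =
  Weights.shuffleClass-sum-zero R F (suc e) (suc n) H Fin.zero q nilpotent T a cs valid
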